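{- Let $s(n,r)$ denote the number of sock patterns of length $n$ containing exactly $r$ distinct socks that are $1$-stack-sortable under $\phi_{aba}$, and let $P_{[q]}(x) := \sum_{n=1}^{\infty}\sum_{r=1}^{\infty} s(n,r)x^nq^r$. Then \[ P_{[q]}(x) = \frac{(-q+(q^2+2q)x-(q^2+2q)x^2) + q\sqrt{1-2(q+2)x+(q^2+2q+4)x^2-2q^2x^3 + q^2x^4}}{2(q+1)(x^2-x)}. \]
   Context: A sock sequence is a finite sequence $p=p_1\cdots p_n$ of elements ("socks") of a fixed infinite alphabet $A$; its length is $n$. A sock sequence is sorted if, for each sock, all its occurrences appear consecutively. Two sock sequences are equivalent if one is obtained from the other by a bijective renaming of socks; a sock pattern is an equivalence class (equivalently, a set partition of $\{1,\dots,n\}$). A sock sequence contains a pattern $\sigma$ if some (not necessarily consecutive) subsequence of it lies in the class $\sigma$. The map $\phi_{aba}$ on sock sequences: read the input left to right, using a stack; let $s$ be the sequence of socks on the stack read from top to bottom. At each step, if input socks remain and pushing the leftmost remaining input sock onto the top of the stack would not make $s$ contain the pattern $aba$, push it; otherwise pop the top sock of the stack and append it to the output. Continue until all socks are in the output; $\phi_{aba}(p)$ is the output. This map commutes with renaming, hence acts on sock patterns. A sock pattern is $1$-stack-sortable under $\phi_{aba}$ if $\phi_{aba}$ of (any representative of) it is sorted. -}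

module Defs where

open import Data.Bool using (Bool; true; false; not; if_then_else_; _∧_)
open import Data.Nat as ℕ using (ℕ; zero; suc; _≡ᵇ_; _∸_)
open import Data.List using (List; []; _∷_; _++_; [_]; length; filter; map; concatMap; upTo; foldr; deduplicate)
open import Data.Integer as ℤ using (ℤ; +_; -[1+_])
open import Data.Product using (_×_; _,_)
open import Relation.Binary.PropositionalEquality using (_≡_)
open import Relation.Nullary.Decidable using (Dec)
open import Relation.Nullary.Decidable using (T?)

Sock : Set
Sock = ℕ

SockSeq : Set
SockSeq = List Sock

memB : Sock → SockSeq → Bool
memB a []       = false
memB a (y ∷ ys) = if a ≡ᵇ y then true else memB a ys

-- abaAfter a l : l contains a subsequence b a with b ≠ a
abaAfter : Sock → SockSeq → Bool
abaAfter a []       = false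
abaAfter a (y ∷ ys) = if a ≡ᵇ y then abaAfter a ys else memB a ys

containsABA : SockSeq → Bool
containsABA []       = false
containsABA (a ∷ as) = abaAfter a as ∨' containsABA as
  where
  _∨'_ : Bool → Bool → Bool
  true  ∨' _ = true
  false ∨' b = b

-- sorted: for each sock, all its occurrences are consecutive, i.e.
-- there are no i < j < k with s_i = s_k and s_j ≠ s_i.
isSorted : SockSeq → Bool
isSorted s = not (containsABA s)

-- The stack map φ_aba. State: remaining input, stack (top first), output.
-- Each step moves one sock, so 2 * length steps suffice (fuel).

run : ℕ → SockSeq → SockSeq → SockSeq → SockSeq
run zero    inp       st       out = out
run (suc k) []        []       out = out
run (suc k) []        (y ∷ st) out = run k [] st (out ++ [ y ])
run (suc k) (x ∷ inp) st       out with containsABA (x ∷ st)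
... | false = run k inp (x ∷ st) out
... | true  with st
...   | []      = out            -- unreachable: [x] never contains aba
...   | y ∷ st' = run k (x ∷ inp) st' (out ++ [ y ])

φaba : SockSeq → SockSeq
φaba p = run (2 ℕ.* length p) p [] []

stackSortable : SockSeq → Bool
stackSortable p = isSorted (φaba p)

-- Sock patterns of length n = set partitions of {1..n}, represented by
-- their unique canonical representative: restricted growth sequences
-- (first sock 0, each new sock is 1 + the largest used so far).

rgsAux : ℕ → ℕ → List SockSeq
rgsAux zero    m = [] ∷ []
rgsAux (suc k) m =
  concatMap (λ v → map (v ∷_) (rgsAux k (if v ≡ᵇ m then suc m else m)))
            (upTo (suc m))

patterns : ℕ → List SockSeq
patterns n = rgsAux n 0

distinctSocks : SockSeq → ℕ
distinctSocks p = length (deduplicate ℕ._≟_ p)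

s : ℕ → ℕ → ℕ
s n r = length (filter (λ p → T? (stackSortable p ∧ (distinctSocks p ≡ᵇ r)))
                       (patterns n))

-- Formal power series in two variables x, q with integer coefficients:
-- F n r = coefficient of x^n q^r.

Ser : Set
Ser = ℕ → ℕ → ℤ

sumTo : ℕ → (ℕ → ℤ) → ℤ
sumTo n f = foldr (λ i acc → f i ℤ.+ acc) (+ 0) (upTo (suc n))

_⊕_ : Ser → Ser → Ser
(F ⊕ G) n r = F n r ℤ.+ G n r

_⊛_ : Ser → Ser → Ser
(F ⊛ G) n r = sumTo n (λ i → sumTo r (λ j → F i j ℤ.* G (n ∸ i) (r ∸ j)))

-- polynomial given by a list of terms (i , j , c) meaning c x^i q^j
poly : List (ℕ × ℕ × ℤ) → Ser
poly []                  n r = + 0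
poly ((i , j , c) ∷ ts) n r =
  (if (i ≡ᵇ n) ∧ (j ≡ᵇ r) then c else + 0) ℤ.+ poly ts n r

Pq : Ser
Pq zero    r       = + 0
Pq (suc n) zero    = + 0
Pq (suc n) (suc r) = + s (suc n) (suc r)

qSer : Ser
qSer = poly ((0 , 1 , + 1) ∷ [])

Nser : Ser
Nser = poly ((0 , 1 , -[1+ 0 ]) ∷ (1 , 2 , + 1) ∷ (1 , 1 , + 2)
           ∷ (2 , 2 , -[1+ 0 ]) ∷ (2 , 1 , -[1+ 1 ]) ∷ [])

Dser : Ser
Dser = poly ((0 , 0 , + 1) ∷ (1 , 1 , -[1+ 1 ]) ∷ (1 , 0 , -[1+ 3 ])
           ∷ (2 , 2 , + 1) ∷ (2 , 1 , + 2) ∷ (2 , 0 , + 4)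
           ∷ (3 , 2 , -[1+ 1 ]) ∷ (4 , 2 , + 1) ∷ [])

-- denominator: 2(q+1)(x² - x) = 2qx² + 2x² - 2qx - 2x
Den : Ser
Den = poly ((2 , 1 , + 2) ∷ (2 , 0 , + 2) ∷ (1 , 1 , -[1+ 1 ]) ∷ (1 , 0 , -[1+ 1 ]) ∷ [])

-- Feed a restricted growth sequence to φaba one sock at a time. The stack is a list of
-- runs of distinct socks, none of which has been output, except that the last output
-- sock may have been pushed back on top; and the final output can only be sorted if
-- the output followed by the stack never contains aba. Which next socks keep this
-- possible, and which shape results, depends only on the number k of runs, on whether
-- the output is empty and on whether the top run was reopened. This gives a transfer
-- recursion whose generating functions T_k in ℤ[[q]][[x]] satisfy linear functional
-- equations. Their unique solution factors as T_{j+1} = T_1 (1 + x (T_1 + ... + T_j)),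
-- which leaves finitely many unknowns; eliminating them, R = x T_1 (so P = q R)
-- satisfies R = (x - x²)(1 + R)(1 + (q + 1) R), and the stated square root is
-- 1 - x ((q + 2)(1 - x) + 2 (q + 1)(1 - x) R).

module Submission where

open import Algebra.Bundles using (CommutativeRing)
open import Algebra.Structures using (IsCommutativeRing)
import Algebra.Construct.Pointwise as Pointwise
import Algebra.Properties.CommutativeSemigroup as CommutativeSemigroupProperties
import Algebra.Properties.Group as GroupProperties
import Algebra.Properties.Ring as RingProperties
import Algebra.Solver.Ring as RingSolver
open import Algebra.Solver.Ring.AlmostCommutativeRing using (fromCommutativeRing; _-Raw-AlmostCommutative⟶_)
import Algebra.Solver.Ring.NaturalCoefficients.Default as NaturalSolver
open import Data.Nat using (ℕ; zero; suc; _∸_; _≤_)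
open import Data.Nat.Properties using (m∸n≤m)
open import Data.Product using (_,_)
open import Function using (_∘_)

module PowerSeries {c ℓ} (A : CommutativeRing c ℓ) where
  open CommutativeRing A renaming (Carrier to C)
  open import Relation.Binary.Reasoning.Setoid setoid
  open NaturalSolver commutativeSemiring using (solve; _:=_; _:+_; _:*_; con)

  sumBelow : (ℕ → C) → ℕ → C
  sumBelow h zero    = 0#
  sumBelow h (suc k) = h 0 + sumBelow (h ∘ suc) k

  conv : (ℕ → C) → (ℕ → C) → ℕ → C
  conv f g n = sumBelow (λ i → f i * g (n ∸ i)) (suc n)

  const : C → ℕ → C
  const a zero    = a
  const a (suc _) = 0#

  var : ℕ → C
  var zero          = 0#
  var (suc zero)    = 1#
  var (suc (suc _)) = 0#

  _≋_ : (ℕ → C) → (ℕ → C) → Set ℓ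
  f ≋ g = ∀ n → f n ≈ g n

  sumBelow-cong : ∀ h h′ k → (∀ i → h i ≈ h′ i) → sumBelow h k ≈ sumBelow h′ k
  sumBelow-cong h h′ zero    _    = refl
  sumBelow-cong h h′ (suc k) h≈h′ = +-cong (h≈h′ 0) (sumBelow-cong (h ∘ suc) (h′ ∘ suc) k (h≈h′ ∘ suc))

  sumBelow-+ : ∀ h h′ k → sumBelow (λ i → h i + h′ i) k ≈ sumBelow h k + sumBelow h′ k
  sumBelow-+ h h′ zero    = sym (+-identityˡ 0#)
  sumBelow-+ h h′ (suc k) = begin
      (h 0 + h′ 0) + sumBelow (λ i → h (suc i) + h′ (suc i)) k
    ≈⟨ +-congˡ (sumBelow-+ (h ∘ suc) (h′ ∘ suc) k) ⟩
      (h 0 + h′ 0) + (sumBelow (h ∘ suc) k + sumBelow (h′ ∘ suc) k)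
    ≈⟨ solve 4 (λ a b x y → (a :+ b) :+ (x :+ y) := (a :+ x) :+ (b :+ y)) refl (h 0) (h′ 0) _ _ ⟩
      (h 0 + sumBelow (h ∘ suc) k) + (h′ 0 + sumBelow (h′ ∘ suc) k)
    ∎

  sumBelow-*ˡ : ∀ a h k → sumBelow (λ i → a * h i) k ≈ a * sumBelow h k
  sumBelow-*ˡ a h zero    = sym (zeroʳ a)
  sumBelow-*ˡ a h (suc k) = trans (+-congˡ (sumBelow-*ˡ a (h ∘ suc) k)) (sym (distribˡ a (h 0) (sumBelow (h ∘ suc) k)))

  sumBelow-0 : ∀ k → sumBelow (λ _ → 0#) k ≈ 0#
  sumBelow-0 zero    = refl
  sumBelow-0 (suc k) = trans (+-identityˡ _) (sumBelow-0 k)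

  conv-cong : ∀ {f f′ g g′} → f ≋ f′ → g ≋ g′ → conv f g ≋ conv f′ g′
  conv-cong f≈f′ g≈g′ n = sumBelow-cong _ _ (suc n) (λ i → *-cong (f≈f′ i) (g≈g′ (n ∸ i)))

  conv-distribˡ : ∀ f g h n → conv f (λ i → g i + h i) n ≈ conv f g n + conv f h n
  conv-distribˡ f g h n = trans (sumBelow-cong _ _ (suc n) (λ i → distribˡ (f i) (g (n ∸ i)) (h (n ∸ i))))
                                (sumBelow-+ (λ i → f i * g (n ∸ i)) (λ i → f i * h (n ∸ i)) (suc n))

  conv-distribʳ : ∀ f f′ g n → conv (λ i → f i + f′ i) g n ≈ conv f g n + conv f′ g n
  conv-distribʳ f f′ g n = trans (sumBelow-cong _ _ (suc n) (λ i → distribʳ (g (n ∸ i)) (f i) (f′ i)))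
                                 (sumBelow-+ (λ i → f i * g (n ∸ i)) (λ i → f′ i * g (n ∸ i)) (suc n))

  conv-*ˡ : ∀ a f g n → conv (λ i → a * f i) g n ≈ a * conv f g n
  conv-*ˡ a f g n = trans (sumBelow-cong _ _ (suc n) (λ i → *-assoc a (f i) (g (n ∸ i))))
                          (sumBelow-*ˡ a (λ i → f i * g (n ∸ i)) (suc n))

  conv-zeroˡ : ∀ g n → conv (λ _ → 0#) g n ≈ 0#
  conv-zeroˡ g n = trans (sumBelow-cong _ _ (suc n) (λ i → zeroˡ (g (n ∸ i)))) (sumBelow-0 (suc n))

  conv-const : ∀ a g n → conv (const a) g n ≈ a * g n
  conv-const a g zero    = +-identityʳ _
  conv-const a g (suc n) = trans (+-congˡ (conv-zeroˡ g n)) (+-identityʳ _)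

  conv-identityˡ : ∀ g n → conv (const 1#) g n ≈ g n
  conv-identityˡ g n = trans (conv-const 1# g n) (*-identityˡ (g n))

  conv-var-zero : ∀ g → conv var g 0 ≈ 0#
  conv-var-zero g = trans (+-identityʳ _) (zeroˡ (g 0))

  conv-var-suc : ∀ g n → conv var g (suc n) ≈ g n
  conv-var-suc g n =
    trans (+-cong (zeroˡ (g (suc n))) (trans (conv-cong {g = g} var-suc (λ _ → refl) n) (conv-identityˡ g n))) (+-identityˡ _)
    where
    var-suc : (var ∘ suc) ≋ const 1#
    var-suc zero    = refl
    var-suc (suc _) = refl

  conv-vanishing : ∀ f g n → (∀ i → i ≤ n → g i ≈ 0#) → conv f g n ≈ 0#
  conv-vanishing f g n g≈0 =
    trans (sumBelow-cong _ (λ _ → 0#) (suc n) (λ i → trans (*-congˡ (g≈0 (n ∸ i) (m∸n≤m n i))) (zeroʳ (f i))))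
          (sumBelow-0 (suc n))

  conv-suc : ∀ f g n → conv f g (suc n) ≈ conv f (g ∘ suc) n + f (suc n) * g 0
  conv-suc f g zero    = solve 2 (λ a b → a :+ (b :+ con 0) := (a :+ con 0) :+ b) refl (f 0 * g 1) (f 1 * g 0)
  conv-suc f g (suc n) = begin
      f 0 * g (suc (suc n)) + conv (f ∘ suc) g (suc n)
    ≈⟨ +-congˡ (conv-suc (f ∘ suc) g n) ⟩
      f 0 * g (suc (suc n)) + (conv (f ∘ suc) (g ∘ suc) n + f (suc (suc n)) * g 0)
    ≈⟨ +-assoc _ _ _ ⟨
      (f 0 * g (suc (suc n)) + conv (f ∘ suc) (g ∘ suc) n) + f (suc (suc n)) * g 0
    ∎

  conv-comm : ∀ f g n → conv f g n ≈ conv g f n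
  conv-comm f g zero    = +-congʳ (*-comm (f 0) (g 0))
  conv-comm f g (suc n) = begin
      f 0 * g (suc n) + conv (f ∘ suc) g n
    ≈⟨ +-cong (*-comm (f 0) (g (suc n))) (conv-comm (f ∘ suc) g n) ⟩
      g (suc n) * f 0 + conv g (f ∘ suc) n
    ≈⟨ +-comm _ _ ⟩
      conv g (f ∘ suc) n + g (suc n) * f 0
    ≈⟨ conv-suc g f n ⟨
      conv g f (suc n)
    ∎

  conv-assoc : ∀ f g h n → conv (conv f g) h n ≈ conv f (conv g h) n
  conv-assoc f g h zero =
    solve 3 (λ a b x → (a :* b :+ con 0) :* x :+ con 0 := a :* (b :* x :+ con 0) :+ con 0) refl (f 0) (g 0) (h 0)
  conv-assoc f g h (suc n) = begin
      conv f g 0 * h (suc n) + conv (λ i → f 0 * g (suc i) + conv (f ∘ suc) g i) h n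
    ≈⟨ +-congˡ (conv-distribʳ (λ i → f 0 * g (suc i)) (conv (f ∘ suc) g) h n) ⟩
      conv f g 0 * h (suc n) + (conv (λ i → f 0 * g (suc i)) h n + conv (conv (f ∘ suc) g) h n)
    ≈⟨ +-congˡ (+-cong (conv-*ˡ (f 0) (g ∘ suc) h n) (conv-assoc (f ∘ suc) g h n)) ⟩
      (f 0 * g 0 + 0#) * h (suc n) + (f 0 * conv (g ∘ suc) h n + conv (f ∘ suc) (conv g h) n)
    ≈⟨ solve 5 (λ a b x y z → (a :* b :+ con 0) :* x :+ (a :* y :+ z) := a :* (b :* x :+ y) :+ z) refl
         (f 0) (g 0) (h (suc n)) (conv (g ∘ suc) h n) (conv (f ∘ suc) (conv g h) n) ⟩
      f 0 * (g 0 * h (suc n) + conv (g ∘ suc) h n) + conv (f ∘ suc) (conv g h) n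
    ∎

  isCommutativeRingˢ : IsCommutativeRing _≋_ (λ f g n → f n + g n) conv (λ f n → - f n) (λ _ → 0#) (const 1#)
  isCommutativeRingˢ = record
    { isRing = record
      { +-isAbelianGroup = Pointwise.isAbelianGroup ℕ +-isAbelianGroup
      ; *-cong           = conv-cong
      ; *-assoc          = conv-assoc
      ; *-identity       = conv-identityˡ , (λ g n → trans (conv-comm g (const 1#) n) (conv-identityˡ g n))
      ; distrib          = conv-distribˡ , (λ h f g → conv-distribʳ f g h)
      }
    ; *-comm = conv-comm
    }

  seriesRing : CommutativeRing c ℓ
  seriesRing = record
    { Carrier           = ℕ → C
    ; _≈_               = _≋_
    ; _+_               = λ f g n → f n + g n
    ; _*_               = conv
    ; -_                = λ f n → - f n
    ; 0#                = λ _ → 0#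
    ; 1#                = const 1#
    ; isCommutativeRing = isCommutativeRingˢ
    }

  const-cong : ∀ {a b} → a ≈ b → const a ≋ const b
  const-cong a≈b zero    = a≈b
  const-cong a≈b (suc n) = refl

  const-+ : ∀ a b → const (a + b) ≋ (λ n → const a n + const b n)
  const-+ a b zero    = refl
  const-+ a b (suc n) = sym (+-identityˡ 0#)

  const-* : ∀ a b → const (a * b) ≋ conv (const a) (const b)
  const-* a b n = sym (trans (conv-const a (const b) n) (lemma n))
    where
    lemma : ∀ n → a * const b n ≈ const (a * b) n
    lemma zero    = refl
    lemma (suc n) = zeroʳ a

  const-‿ : ∀ a → const (- a) ≋ (λ n → - const a n)
  const-‿ a zero    = refl
  const-‿ a (suc n) = sym (RingProperties.-0#≈0# ring)

-- Imported only after PowerSeries, whose opened ring operations and setoid laws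
-- would clash with ℕ's _+_ and with the refl of _≡_.
open import Defs
open import Data.Bool using (Bool; true; false; if_then_else_; _∧_; _∨_)
open import Data.Bool.Properties using (∨-assoc; ∨-idem; ∨-identityʳ; ∨-zeroʳ; ∧-zeroʳ)
open import Data.Empty using (⊥; ⊥-elim)
open import Data.List using (List; []; _∷_; _++_; [_]; length; filter; map; concatMap; upTo; replicate; deduplicate; foldr; applyUpTo)
open import Data.List.Properties using (++-assoc; ++-identityʳ; map-++; map-cong; length-++; filter-++; upTo-∷ʳ)
open import Data.Nat as ℕ using (_+_; _*_; _≡ᵇ_; _<ᵇ_; _<_; s≤s)
open import Data.Nat.ListAction using (sum)
open import Data.Nat.ListAction.Properties using (sum-++)
open import Data.Nat.Properties using (+-commutativeSemigroup; +-comm; +-identityʳ; +-suc; *-comm; suc-injective; ≤-refl; ≤-reflexive; ≤-trans; n≤1+n; <-irrefl; ≤-<-trans; m≤n⇒m≤1+n; n<1+n)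
open import Data.Product using (_×_; proj₁; proj₂; ∃)
open import Data.Sum using (_⊎_; inj₁; inj₂)
open import Relation.Binary.PropositionalEquality hiding ([_])
open import Relation.Nullary using (¬_; yes; no)
open import Relation.Nullary.Decidable using (¬?; T?)

≡ᵇ-refl : ∀ a → (a ≡ᵇ a) ≡ true
≡ᵇ-refl zero    = refl
≡ᵇ-refl (suc a) = ≡ᵇ-refl a

≡ᵇ-true⇒≡ : ∀ a b → (a ≡ᵇ b) ≡ true → a ≡ b
≡ᵇ-true⇒≡ zero    zero    _ = refl
≡ᵇ-true⇒≡ (suc a) (suc b) e = cong suc (≡ᵇ-true⇒≡ a b e)

≢⇒≡ᵇ-false : ∀ a b → ¬ a ≡ b → (a ≡ᵇ b) ≡ false
≢⇒≡ᵇ-false zero    zero    a≢b = ⊥-elim (a≢b refl)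
≢⇒≡ᵇ-false zero    (suc b) _   = refl
≢⇒≡ᵇ-false (suc a) zero    _   = refl
≢⇒≡ᵇ-false (suc a) (suc b) a≢b = ≢⇒≡ᵇ-false a b (a≢b ∘ cong suc)

true≢false : ∀ {b} → b ≡ true → b ≡ false → ⊥
true≢false refl ()

≡ᵇ-cases : ∀ a b → ((a ≡ᵇ b) ≡ true × a ≡ b) ⊎ ((a ≡ᵇ b) ≡ false × ¬ a ≡ b)
≡ᵇ-cases a b with a ≡ᵇ b in e
... | true  = inj₁ (refl , ≡ᵇ-true⇒≡ a b e)
... | false = inj₂ (refl , λ { refl → true≢false (≡ᵇ-refl a) e })

contraposeᵇ : ∀ {b c} → (b ≡ true → c ≡ true) → c ≡ false → b ≡ false
contraposeᵇ {false} _   _       = refl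
contraposeᵇ {true}  b⇒c c≡false = ⊥-elim (true≢false (b⇒c refl) c≡false)

∨-trueˡ : ∀ {x} y → x ≡ true → (x ∨ y) ≡ true
∨-trueˡ _ refl = refl

∨-trueʳ : ∀ x {y} → y ≡ true → (x ∨ y) ≡ true
∨-trueʳ x refl = ∨-zeroʳ x

memB-here : ∀ a ys → memB a (a ∷ ys) ≡ true
memB-here a ys rewrite ≡ᵇ-refl a = refl

memB-there : ∀ a y ys → memB a ys ≡ true → memB a (y ∷ ys) ≡ true
memB-there a y ys h with a ≡ᵇ y
... | true  = refl
... | false = h

memB-∷-≢ : ∀ a y ys → ¬ a ≡ y → memB a (y ∷ ys) ≡ memB a ys
memB-∷-≢ a y ys a≢y rewrite ≢⇒≡ᵇ-false a y a≢y = refl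

memB-∷⁻ : ∀ a y ys → memB a (y ∷ ys) ≡ true → a ≡ y ⊎ memB a ys ≡ true
memB-∷⁻ a y ys h with ≡ᵇ-cases a y
... | inj₁ (_ , a≡y) = inj₁ a≡y
... | inj₂ (_ , a≢y) = inj₂ (trans (sym (memB-∷-≢ a y ys a≢y)) h)

memB-singleton : ∀ a v → memB a [ v ] ≡ (a ≡ᵇ v)
memB-singleton a v with a ≡ᵇ v
... | true  = refl
... | false = refl

memB-++ : ∀ a xs ys → memB a (xs ++ ys) ≡ (memB a xs ∨ memB a ys)
memB-++ a []       ys = refl
memB-++ a (y ∷ xs) ys with a ≡ᵇ y
... | true  = refl
... | false = memB-++ a xs ys

memB-++⁺ˡ : ∀ a xs ys → memB a xs ≡ true → memB a (xs ++ ys) ≡ true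
memB-++⁺ˡ a xs ys h = trans (memB-++ a xs ys) (∨-trueˡ _ h)

memB-++⁺ʳ : ∀ a xs ys → memB a ys ≡ true → memB a (xs ++ ys) ≡ true
memB-++⁺ʳ a xs ys h = trans (memB-++ a xs ys) (∨-trueʳ _ h)

memB-++⁻ : ∀ a xs ys → memB a (xs ++ ys) ≡ true → memB a xs ≡ true ⊎ memB a ys ≡ true
memB-++⁻ a xs ys h with memB a xs in e
... | true  = inj₁ refl
... | false = inj₂ (trans (sym (trans (memB-++ a xs ys) (cong (_∨ memB a ys) e))) h)

memB-∷ʳ-last : ∀ L o → memB L (o ++ [ L ]) ≡ true
memB-∷ʳ-last L o = memB-++⁺ʳ L o [ L ] (memB-here L [])

memB-insert : ∀ a xs x ys → memB a (xs ++ ys) ≡ true → memB a (xs ++ x ∷ ys) ≡ true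
memB-insert a []       x ys h = memB-there a x ys h
memB-insert a (y ∷ xs) x ys h with a ≡ᵇ y
... | true  = refl
... | false = memB-insert a xs x ys h

memB-dup : ∀ a xs x ys → memB a (xs ++ x ∷ x ∷ ys) ≡ memB a (xs ++ x ∷ ys)
memB-dup a []       x ys with a ≡ᵇ x
... | true  = refl
... | false = refl
memB-dup a (y ∷ xs) x ys with a ≡ᵇ y
... | true  = refl
... | false = memB-dup a xs x ys

abaAfter⇒memB : ∀ a ys → abaAfter a ys ≡ true → memB a ys ≡ true
abaAfter⇒memB a (y ∷ ys) h with a ≡ᵇ y
... | true  = refl
... | false = h

abaAfter-∷-≢ : ∀ a y ys → ¬ a ≡ y → abaAfter a (y ∷ ys) ≡ memB a ys
abaAfter-∷-≢ a y ys a≢y rewrite ≢⇒≡ᵇ-false a y a≢y = refl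

abaAfter-∉ : ∀ a ys → memB a ys ≡ false → abaAfter a ys ≡ false
abaAfter-∉ a ys = contraposeᵇ (abaAfter⇒memB a ys)

abaAfter-++⁺ˡ : ∀ a xs ys → abaAfter a xs ≡ true → abaAfter a (xs ++ ys) ≡ true
abaAfter-++⁺ˡ a (y ∷ xs) ys h with a ≡ᵇ y
... | true  = abaAfter-++⁺ˡ a xs ys h
... | false = memB-++⁺ˡ a xs ys h

abaAfter-insert : ∀ a xs x ys → abaAfter a (xs ++ ys) ≡ true → abaAfter a (xs ++ x ∷ ys) ≡ true
abaAfter-insert a []       x ys h with a ≡ᵇ x
... | true  = h
... | false = abaAfter⇒memB a ys h
abaAfter-insert a (y ∷ xs) x ys h with a ≡ᵇ y
... | true  = abaAfter-insert a xs x ys h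
... | false = memB-insert a xs x ys h

abaAfter-dup : ∀ a xs x ys → abaAfter a (xs ++ x ∷ x ∷ ys) ≡ abaAfter a (xs ++ x ∷ ys)
abaAfter-dup a []       x ys with a ≡ᵇ x
... | true  = refl
... | false = refl
abaAfter-dup a (y ∷ xs) x ys with a ≡ᵇ y
... | true  = abaAfter-dup a xs x ys
... | false = memB-dup a xs x ys

abaAfter-++-∉ : ∀ a xs ys → memB a ys ≡ false → abaAfter a (xs ++ ys) ≡ abaAfter a xs
abaAfter-++-∉ a []       ys h = abaAfter-∉ a ys h
abaAfter-++-∉ a (y ∷ xs) ys h with a ≡ᵇ y
... | true  = abaAfter-++-∉ a xs ys h
... | false = trans (memB-++ a xs ys) (trans (cong (memB a xs ∨_) h) (∨-identityʳ _))

abaAfter-return : ∀ v l L r → ¬ L ≡ v → abaAfter v (l ++ L ∷ v ∷ r) ≡ true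
abaAfter-return v []      L r L≢v = trans (abaAfter-∷-≢ v L (v ∷ r) (L≢v ∘ sym)) (memB-here v r)
abaAfter-return v (y ∷ l) L r L≢v with v ≡ᵇ y
... | true  = abaAfter-return v l L r L≢v
... | false = memB-++⁺ʳ v l (L ∷ v ∷ r) (memB-there v L (v ∷ r) (memB-here v r))

containsABA-∷ : ∀ a as → containsABA (a ∷ as) ≡ (abaAfter a as ∨ containsABA as)
containsABA-∷ a as with abaAfter a as
... | true  = refl
... | false = refl

containsABA-here : ∀ a as → abaAfter a as ≡ true → containsABA (a ∷ as) ≡ true
containsABA-here a as h = trans (containsABA-∷ a as) (∨-trueˡ _ h)

containsABA-there : ∀ a as → containsABA as ≡ true → containsABA (a ∷ as) ≡ true
containsABA-there a as h = trans (containsABA-∷ a as) (∨-trueʳ _ h)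

containsABA-++⁺ʳ : ∀ xs ys → containsABA ys ≡ true → containsABA (xs ++ ys) ≡ true
containsABA-++⁺ʳ []       ys h = h
containsABA-++⁺ʳ (x ∷ xs) ys h = containsABA-there x (xs ++ ys) (containsABA-++⁺ʳ xs ys h)

containsABA-++⁺ˡ : ∀ xs ys → containsABA xs ≡ true → containsABA (xs ++ ys) ≡ true
containsABA-++⁺ˡ (x ∷ xs) ys h with abaAfter x xs in e
... | true  = containsABA-here x (xs ++ ys) (abaAfter-++⁺ˡ x xs ys e)
... | false = containsABA-there x (xs ++ ys) (containsABA-++⁺ˡ xs ys h)

containsABA-insert : ∀ xs x ys → containsABA (xs ++ ys) ≡ true → containsABA (xs ++ x ∷ ys) ≡ true
containsABA-insert []       x ys h = containsABA-there x ys h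
containsABA-insert (y ∷ xs) x ys h with abaAfter y (xs ++ ys) in e
... | true  = containsABA-here y (xs ++ x ∷ ys) (abaAfter-insert y xs x ys e)
... | false = containsABA-there y (xs ++ x ∷ ys) (containsABA-insert xs x ys h)

containsABA-dup : ∀ xs x ys → containsABA (xs ++ x ∷ x ∷ ys) ≡ containsABA (xs ++ x ∷ ys)
containsABA-dup [] x ys = begin
    containsABA (x ∷ x ∷ ys)
  ≡⟨ containsABA-∷ x (x ∷ ys) ⟩
    abaAfter x (x ∷ ys) ∨ containsABA (x ∷ ys)
  ≡⟨ cong (_∨ containsABA (x ∷ ys)) abaAfter-skip ⟩
    abaAfter x ys ∨ containsABA (x ∷ ys)
  ≡⟨ cong (abaAfter x ys ∨_) (containsABA-∷ x ys) ⟩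
    abaAfter x ys ∨ (abaAfter x ys ∨ containsABA ys)
  ≡⟨ sym (∨-assoc (abaAfter x ys) _ _) ⟩
    (abaAfter x ys ∨ abaAfter x ys) ∨ containsABA ys
  ≡⟨ cong (_∨ containsABA ys) (∨-idem _) ⟩
    abaAfter x ys ∨ containsABA ys
  ≡⟨ containsABA-∷ x ys ⟨
    containsABA (x ∷ ys) ∎
  where
  open ≡-Reasoning
  abaAfter-skip : abaAfter x (x ∷ ys) ≡ abaAfter x ys
  abaAfter-skip rewrite ≡ᵇ-refl x = refl
containsABA-dup (y ∷ xs) x ys = begin
    containsABA (y ∷ xs ++ x ∷ x ∷ ys)
  ≡⟨ containsABA-∷ y (xs ++ x ∷ x ∷ ys) ⟩
    abaAfter y (xs ++ x ∷ x ∷ ys) ∨ containsABA (xs ++ x ∷ x ∷ ys)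
  ≡⟨ cong₂ _∨_ (abaAfter-dup y xs x ys) (containsABA-dup xs x ys) ⟩
    abaAfter y (xs ++ x ∷ ys) ∨ containsABA (xs ++ x ∷ ys)
  ≡⟨ containsABA-∷ y (xs ++ x ∷ ys) ⟨
    containsABA (y ∷ xs ++ x ∷ ys) ∎
  where open ≡-Reasoning

containsABA-++-disjoint : ∀ xs ys → (∀ a → memB a xs ≡ true → memB a ys ≡ false) →
                          containsABA (xs ++ ys) ≡ (containsABA xs ∨ containsABA ys)
containsABA-++-disjoint []       ys _    = refl
containsABA-++-disjoint (x ∷ xs) ys disj = begin
    containsABA (x ∷ xs ++ ys)
  ≡⟨ containsABA-∷ x (xs ++ ys) ⟩
    abaAfter x (xs ++ ys) ∨ containsABA (xs ++ ys)
  ≡⟨ cong₂ _∨_ (abaAfter-++-∉ x xs ys (disj x (memB-here x xs)))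
               (containsABA-++-disjoint xs ys (λ a h → disj a (memB-there a x xs h))) ⟩
    abaAfter x xs ∨ (containsABA xs ∨ containsABA ys)
  ≡⟨ ∨-assoc (abaAfter x xs) _ _ ⟨
    (abaAfter x xs ∨ containsABA xs) ∨ containsABA ys
  ≡⟨ cong (_∨ containsABA ys) (containsABA-∷ x xs) ⟨
    containsABA (x ∷ xs) ∨ containsABA ys ∎
  where open ≡-Reasoning

containsABA-return : ∀ v o L r → memB v o ≡ true → ¬ L ≡ v → containsABA (o ++ L ∷ v ∷ r) ≡ true
containsABA-return v (y ∷ o) L r h L≢v with v ≡ᵇ y in e
... | true rewrite ≡ᵇ-true⇒≡ v y e = containsABA-here y (o ++ L ∷ y ∷ r) (abaAfter-return y o L r L≢v)
... | false = containsABA-there y (o ++ L ∷ v ∷ r) (containsABA-return v o L r h L≢v)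

-- Each remaining input sock is pushed and popped once and each stacked sock is popped
-- once, so this fuel is exact.
finish : SockSeq → SockSeq → SockSeq → SockSeq
finish w st out = run (2 * length w + length st) w st out

φaba≡finish : ∀ p → φaba p ≡ finish p [] []
φaba≡finish p = cong (λ k → run k p [] []) (sym (+-identityʳ (2 * length p)))

finish-[] : ∀ st out → finish [] st out ≡ out ++ st
finish-[] []       out = sym (++-identityʳ out)
finish-[] (y ∷ st) out = trans (finish-[] st (out ++ [ y ])) (++-assoc out [ y ] st)

fuel-push : ∀ n s → 2 * suc n + s ≡ suc (2 * n + suc s)
fuel-push n s = begin
    2 * suc n + s           ≡⟨ cong (_+ s) (*-comm 2 (suc n)) ⟩
    suc (suc (n * 2)) + s   ≡⟨ cong (λ z → suc (suc z) + s) (*-comm n 2) ⟩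
    suc (suc (2 * n + s))   ≡⟨ cong suc (+-suc (2 * n) s) ⟨
    suc (2 * n + suc s)     ∎
  where open ≡-Reasoning

finish-push : ∀ x w st out → containsABA (x ∷ st) ≡ false → finish (x ∷ w) st out ≡ finish w (x ∷ st) out
finish-push x w st out ok =
  trans (cong (λ k → run k (x ∷ w) st out) (fuel-push (length w) (length st))) (step _ ok)
  where
  step : ∀ k → containsABA (x ∷ st) ≡ false → run (suc k) (x ∷ w) st out ≡ run k w (x ∷ st) out
  step k _ with containsABA (x ∷ st)
  step k refl | .false = refl

finish-pop : ∀ x w y st out → containsABA (x ∷ y ∷ st) ≡ true →
             finish (x ∷ w) (y ∷ st) out ≡ finish (x ∷ w) st (out ++ [ y ])
finish-pop x w y st out blocked =
  trans (cong (λ k → run k (x ∷ w) (y ∷ st) out) (+-suc (2 * suc (length w)) (length st))) (step _ blocked)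
  where
  step : ∀ k → containsABA (x ∷ y ∷ st) ≡ true → run (suc k) (x ∷ w) (y ∷ st) out ≡ run k (x ∷ w) st (out ++ [ y ])
  step k _ with containsABA (x ∷ y ∷ st)
  step k refl | .true = refl

-- Pushing inserts a sock into the word out ++ st and popping leaves it unchanged,
-- so an occurrence of aba in it survives to the final output.
run-keeps-aba : ∀ k w st out → k ≡ 2 * length w + length st → containsABA (out ++ st) ≡ true →
                containsABA (run k w st out) ≡ true
run-keeps-aba zero    []      []       out _ h = subst (λ l → containsABA l ≡ true) (++-identityʳ out) h
run-keeps-aba (suc k) []      (y ∷ st) out e h =
  run-keeps-aba k [] st (out ++ [ y ]) (suc-injective e) (subst (λ l → containsABA l ≡ true) (sym (++-assoc out [ y ] st)) h)
run-keeps-aba zero    (x ∷ w) st out e _ with () ← trans e (fuel-push (length w) (length st))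
run-keeps-aba (suc k) (x ∷ w) st out e h with containsABA (x ∷ st) in blocked
... | false = run-keeps-aba k w (x ∷ st) out (suc-injective (trans e (fuel-push (length w) (length st))))
                (containsABA-insert out x st h)
... | true with st
...   | []       with () ← blocked
...   | y ∷ st′ = run-keeps-aba k (x ∷ w) st′ (out ++ [ y ])
                  (suc-injective (trans e (+-suc (2 * suc (length w)) (length st′))))
                  (subst (λ l → containsABA l ≡ true) (sym (++-assoc out [ y ] st′)) h)

finish-keeps-aba : ∀ w st out → containsABA (out ++ st) ≡ true → containsABA (finish w st out) ≡ true
finish-keeps-aba w st out = run-keeps-aba _ w st out refl

nDistinct : SockSeq → ℕ
nDistinct []       = 0
nDistinct (x ∷ xs) = if memB x xs then nDistinct xs else suc (nDistinct xs)

data NoDup : SockSeq → Set where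
  []  : NoDup []
  _∷_ : ∀ {y ys} → memB y ys ≡ false → NoDup ys → NoDup (y ∷ ys)

remove : Sock → SockSeq → SockSeq
remove x = filter (¬? ∘ (x ℕ.≟_))

remove-here : ∀ x ys → remove x (x ∷ ys) ≡ remove x ys
remove-here x ys rewrite ≡ᵇ-refl x = refl

remove-there : ∀ x y ys → ¬ x ≡ y → remove x (y ∷ ys) ≡ y ∷ remove x ys
remove-there x y ys x≢y rewrite ≢⇒≡ᵇ-false x y x≢y = refl

remove-∉ : ∀ x ys → memB x ys ≡ false → remove x ys ≡ ys
remove-∉ x []       _ = refl
remove-∉ x (y ∷ ys) h with ≡ᵇ-cases x y
... | inj₁ (_ , refl) = ⊥-elim (true≢false (memB-here x ys) h)
... | inj₂ (_ , x≢y)  =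
  trans (remove-there x y ys x≢y) (cong (y ∷_) (remove-∉ x ys (trans (sym (memB-∷-≢ x y ys x≢y)) h)))

memB-remove-≢ : ∀ a x ys → ¬ a ≡ x → memB a (remove x ys) ≡ memB a ys
memB-remove-≢ a x []       _   = refl
memB-remove-≢ a x (y ∷ ys) a≢x with ≡ᵇ-cases x y
... | inj₁ (_ , refl) =
  trans (cong (memB a) (remove-here x ys)) (trans (memB-remove-≢ a x ys a≢x) (sym (memB-∷-≢ a x ys a≢x)))
... | inj₂ (_ , x≢y)  rewrite remove-there x y ys x≢y with a ≡ᵇ y
...   | true  = refl
...   | false = memB-remove-≢ a x ys a≢x

memB-remove-self : ∀ x ys → memB x (remove x ys) ≡ false
memB-remove-self x []       = refl
memB-remove-self x (y ∷ ys) with ≡ᵇ-cases x y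
... | inj₁ (_ , refl) = trans (cong (memB x) (remove-here x ys)) (memB-remove-self x ys)
... | inj₂ (_ , x≢y)  =
  trans (cong (memB x) (remove-there x y ys x≢y)) (trans (memB-∷-≢ x y (remove x ys) x≢y) (memB-remove-self x ys))

memB-remove-∉ : ∀ a x ys → memB a ys ≡ false → memB a (remove x ys) ≡ false
memB-remove-∉ a x ys h with ≡ᵇ-cases a x
... | inj₁ (_ , refl) = memB-remove-self a ys
... | inj₂ (_ , a≢x)  = trans (memB-remove-≢ a x ys a≢x) h

NoDup-remove : ∀ x ys → NoDup ys → NoDup (remove x ys)
NoDup-remove x []       []         = []
NoDup-remove x (y ∷ ys) (y∉ ∷ nd) with ≡ᵇ-cases x y
... | inj₁ (_ , refl) = subst NoDup (sym (remove-here x ys)) (NoDup-remove x ys nd)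
... | inj₂ (_ , x≢y)  = subst NoDup (sym (remove-there x y ys x≢y)) (memB-remove-∉ y x ys y∉ ∷ NoDup-remove x ys nd)

length-remove-∈ : ∀ x ys → NoDup ys → memB x ys ≡ true → suc (length (remove x ys)) ≡ length ys
length-remove-∈ x (y ∷ ys) (y∉ ∷ nd) h with ≡ᵇ-cases x y
... | inj₁ (_ , refl) = cong (suc ∘ length) (trans (remove-here x ys) (remove-∉ x ys y∉))
... | inj₂ (_ , x≢y)  = cong suc (trans (cong length (remove-there x y ys x≢y))
                                        (length-remove-∈ x ys nd (trans (sym (memB-∷-≢ x y ys x≢y)) h)))

dedup : SockSeq → SockSeq
dedup = deduplicate ℕ._≟_

memB-dedup : ∀ a xs → memB a (dedup xs) ≡ memB a xs
memB-dedup a []       = refl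
memB-dedup a (x ∷ xs) with ≡ᵇ-cases a x
... | inj₁ (_ , refl) rewrite ≡ᵇ-refl a = refl
... | inj₂ (_ , a≢x)  = begin
    memB a (x ∷ remove x (dedup xs))   ≡⟨ memB-∷-≢ a x (remove x (dedup xs)) a≢x ⟩
    memB a (remove x (dedup xs))       ≡⟨ memB-remove-≢ a x (dedup xs) a≢x ⟩
    memB a (dedup xs)                  ≡⟨ memB-dedup a xs ⟩
    memB a xs                          ≡⟨ memB-∷-≢ a x xs a≢x ⟨
    memB a (x ∷ xs)                    ∎
  where open ≡-Reasoning

NoDup-dedup : ∀ xs → NoDup (dedup xs)
NoDup-dedup []       = []
NoDup-dedup (x ∷ xs) = memB-remove-self x (dedup xs) ∷ NoDup-remove x (dedup xs) (NoDup-dedup xs)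

distinctSocks≡nDistinct : ∀ xs → distinctSocks xs ≡ nDistinct xs
distinctSocks≡nDistinct []       = refl
distinctSocks≡nDistinct (x ∷ xs) with memB x xs in x∈?
... | true  = trans (length-remove-∈ x (dedup xs) (NoDup-dedup xs) (trans (memB-dedup x xs) x∈?))
                    (distinctSocks≡nDistinct xs)
... | false = cong suc (trans (cong length (remove-∉ x (dedup xs) (trans (memB-dedup x xs) x∈?)))
                              (distinctSocks≡nDistinct xs))

nDistinct-∷ʳ : ∀ l y → nDistinct (l ++ [ y ]) ≡ (if memB y l then nDistinct l else suc (nDistinct l))
nDistinct-∷ʳ []      y = refl
nDistinct-∷ʳ (x ∷ l) y rewrite memB-++ x l [ y ] | memB-singleton x y with ≡ᵇ-cases x y
... | inj₁ (e , refl) rewrite e | ∨-zeroʳ (memB x l) | ≡ᵇ-refl x = nDistinct-∷ʳ l x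
... | inj₂ (e , x≢y) rewrite e | ≢⇒≡ᵇ-false y x (x≢y ∘ sym) | ∨-identityʳ (memB x l) | nDistinct-∷ʳ l y
  with memB x l | memB y l
...   | true  | true  = refl
...   | true  | false = refl
...   | false | true  = refl
...   | false | false = refl

nDistinct-mono : ∀ u w → nDistinct u ≤ nDistinct (u ++ w)
nDistinct-mono u []      rewrite ++-identityʳ u = ≤-refl
nDistinct-mono u (y ∷ w) = ≤-trans snoc-step
  (subst (λ l → nDistinct (u ++ [ y ]) ≤ nDistinct l) (++-assoc u [ y ] w) (nDistinct-mono (u ++ [ y ]) w))
  where
  snoc-step : nDistinct u ≤ nDistinct (u ++ [ y ])
  snoc-step rewrite nDistinct-∷ʳ u y with memB y u
  ... | true  = ≤-refl
  ... | false = n≤1+n _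

countWhere : (SockSeq → Bool) → List SockSeq → ℕ
countWhere P L = length (filter (λ w → T? (P w)) L)

countWhere-∷ : ∀ P w L → countWhere P (w ∷ L) ≡ (if P w then 1 else 0) + countWhere P L
countWhere-∷ P w L with P w
... | true  = refl
... | false = refl

countWhere-++ : ∀ P xs ys → countWhere P (xs ++ ys) ≡ countWhere P xs + countWhere P ys
countWhere-++ P xs ys = trans (cong length (filter-++ (λ w → T? (P w)) xs ys)) (length-++ (filter _ xs))

countWhere-concatMap : ∀ P (f : ℕ → List SockSeq) vs →
                       countWhere P (concatMap f vs) ≡ sum (map (λ v → countWhere P (f v)) vs)
countWhere-concatMap P f []       = refl
countWhere-concatMap P f (v ∷ vs) =
  trans (countWhere-++ P (f v) (concatMap f vs)) (cong (countWhere P (f v) +_) (countWhere-concatMap P f vs))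

countWhere-map-∷ : ∀ P v L → countWhere P (map (v ∷_) L) ≡ countWhere (λ w → P (v ∷ w)) L
countWhere-map-∷ P v []      = refl
countWhere-map-∷ P v (w ∷ L) = trans (countWhere-∷ P (v ∷ w) (map (v ∷_) L))
  (trans (cong ((if P (v ∷ w) then 1 else 0) +_) (countWhere-map-∷ P v L)) (sym (countWhere-∷ (λ w → P (v ∷ w)) w L)))

countWhere-cong : ∀ {P Q} L → (∀ w → P w ≡ Q w) → countWhere P L ≡ countWhere Q L
countWhere-cong                []      _   = refl
countWhere-cong {P} {Q} (w ∷ L) P≗Q = begin
    countWhere P (w ∷ L)                       ≡⟨ countWhere-∷ P w L ⟩
    (if P w then 1 else 0) + countWhere P L    ≡⟨ cong₂ (λ b n → (if b then 1 else 0) + n) (P≗Q w) (countWhere-cong L P≗Q) ⟩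
    (if Q w then 1 else 0) + countWhere Q L    ≡⟨ countWhere-∷ Q w L ⟨
    countWhere Q (w ∷ L)                       ∎
  where open ≡-Reasoning

countWhere-none : ∀ P L → (∀ w → P w ≡ false) → countWhere P L ≡ 0
countWhere-none P L none = trans (countWhere-cong L none) (count-false L)
  where
  count-false : ∀ L → countWhere (λ _ → false) L ≡ 0
  count-false []      = refl
  count-false (_ ∷ L) = count-false L

<ᵇ-suc : ∀ v m → (v <ᵇ suc m) ≡ ((v <ᵇ m) ∨ (v ≡ᵇ m))
<ᵇ-suc zero    zero    = refl
<ᵇ-suc zero    (suc m) = refl
<ᵇ-suc (suc v) zero    = refl
<ᵇ-suc (suc v) (suc m) = <ᵇ-suc v m

<ᵇ⇒≢ : ∀ v m → (v <ᵇ m) ≡ true → ¬ v ≡ m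
<ᵇ⇒≢ (suc v) (suc m) v<m = <ᵇ⇒≢ v m v<m ∘ suc-injective

<ᵇ-irrefl : ∀ m → (m <ᵇ m) ≡ false
<ᵇ-irrefl zero    = refl
<ᵇ-irrefl (suc m) = <ᵇ-irrefl m

<ᵇ-self : ∀ m → (m <ᵇ suc m) ≡ true
<ᵇ-self zero    = refl
<ᵇ-self (suc m) = <ᵇ-self m

<ᵇ-step : ∀ v m → (v <ᵇ m) ≡ true → (v <ᵇ suc m) ≡ true
<ᵇ-step v m h = trans (<ᵇ-suc v m) (∨-trueˡ _ h)

<ᵇ-suc-≢ : ∀ v m → (v <ᵇ suc m) ≡ true → ¬ v ≡ m → (v <ᵇ m) ≡ true
<ᵇ-suc-≢ v m h v≢m with v <ᵇ m | trans (sym (<ᵇ-suc v m)) h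
... | true  | _ = refl
... | false | e rewrite ≢⇒≡ᵇ-false v m v≢m with () ← e

∉-bound : ∀ m l → (∀ x → memB x l ≡ true → (x <ᵇ m) ≡ true) → memB m l ≡ false
∉-bound m l bound = contraposeᵇ (λ m∈l → trans (sym (<ᵇ-irrefl m)) (bound m m∈l)) refl

sum-map-remove : ∀ (g : ℕ → ℕ) x ℓ → NoDup ℓ → memB x ℓ ≡ true →
                 sum (map g ℓ) ≡ g x + sum (map g (remove x ℓ))
sum-map-remove g x (y ∷ ℓ) (y∉ ∷ nd) h with ≡ᵇ-cases x y
... | inj₁ (_ , refl) = cong (λ l → g x + sum (map g l)) (sym (trans (remove-here x ℓ) (remove-∉ x ℓ y∉)))
... | inj₂ (_ , x≢y)  = begin
    g y + sum (map g ℓ)                        ≡⟨ cong (g y +_) (sum-map-remove g x ℓ nd (trans (sym (memB-∷-≢ x y ℓ x≢y)) h)) ⟩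
    g y + (g x + sum (map g (remove x ℓ)))     ≡⟨ x∙yz≈y∙xz (g y) (g x) _ ⟩
    g x + sum (map g (y ∷ remove x ℓ))         ≡⟨ cong (λ l → g x + sum (map g l)) (remove-there x y ℓ x≢y) ⟨
    g x + sum (map g (remove x (y ∷ ℓ)))       ∎
  where
  open ≡-Reasoning
  open CommutativeSemigroupProperties +-commutativeSemigroup using (x∙yz≈y∙xz)

sum-upTo-snoc : ∀ (g : ℕ → ℕ) m → sum (map g (upTo (suc m))) ≡ sum (map g (upTo m)) + g m
sum-upTo-snoc g m = begin
    sum (map g (upTo (suc m)))                ≡⟨ cong (sum ∘ map g) (upTo-∷ʳ m) ⟨
    sum (map g (upTo m ++ [ m ]))             ≡⟨ cong sum (map-++ g (upTo m) [ m ]) ⟩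
    sum (map g (upTo m) ++ [ g m ])           ≡⟨ sum-++ (map g (upTo m)) [ g m ] ⟩
    sum (map g (upTo m)) + (g m + 0)          ≡⟨ cong (sum (map g (upTo m)) +_) (+-identityʳ (g m)) ⟩
    sum (map g (upTo m)) + g m                ∎
  where open ≡-Reasoning

sum-upTo-support : ∀ m ℓ (g : ℕ → ℕ) → NoDup ℓ → (∀ v → memB v ℓ ≡ true → (v <ᵇ m) ≡ true) →
                   (∀ v → (v <ᵇ m) ≡ true → memB v ℓ ≡ false → g v ≡ 0) →
                   sum (map g (upTo m)) ≡ sum (map g ℓ)
sum-upTo-support zero    []      g _  _     _      = refl
sum-upTo-support zero    (y ∷ ℓ) g _  bound _      with () ← bound y (memB-here y ℓ)
sum-upTo-support (suc m) ℓ       g nd bound vanish with memB m ℓ in m∈?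
... | true  = begin
    sum (map g (upTo (suc m)))                ≡⟨ sum-upTo-snoc g m ⟩
    sum (map g (upTo m)) + g m                ≡⟨ cong (_+ g m) (sum-upTo-support m (remove m ℓ) g (NoDup-remove m ℓ nd) bound′ vanish′) ⟩
    sum (map g (remove m ℓ)) + g m            ≡⟨ +-comm _ (g m) ⟩
    g m + sum (map g (remove m ℓ))            ≡⟨ sum-map-remove g m ℓ nd m∈? ⟨
    sum (map g ℓ)                             ∎
  where
  open ≡-Reasoning
  bound′ : ∀ v → memB v (remove m ℓ) ≡ true → (v <ᵇ m) ≡ true
  bound′ v h with ≡ᵇ-cases v m
  ... | inj₁ (_ , refl) = ⊥-elim (true≢false h (memB-remove-self v ℓ))
  ... | inj₂ (_ , v≢m)  = <ᵇ-suc-≢ v m (bound v (trans (sym (memB-remove-≢ v m ℓ v≢m)) h)) v≢m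
  vanish′ : ∀ v → (v <ᵇ m) ≡ true → memB v (remove m ℓ) ≡ false → g v ≡ 0
  vanish′ v v<m h = vanish v (<ᵇ-step v m v<m) (trans (sym (memB-remove-≢ v m ℓ (<ᵇ⇒≢ v m v<m))) h)
... | false = begin
    sum (map g (upTo (suc m)))                ≡⟨ sum-upTo-snoc g m ⟩
    sum (map g (upTo m)) + g m                ≡⟨ cong₂ _+_ (sum-upTo-support m ℓ g nd bound′ vanish′) (vanish m (<ᵇ-self m) m∈?) ⟩
    sum (map g ℓ) + 0                         ≡⟨ +-identityʳ _ ⟩
    sum (map g ℓ)                             ∎
  where
  open ≡-Reasoning
  bound′ : ∀ v → memB v ℓ ≡ true → (v <ᵇ m) ≡ true
  bound′ v h with ≡ᵇ-cases v m
  ... | inj₁ (_ , refl) = ⊥-elim (true≢false h m∈?)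
  ... | inj₂ (_ , v≢m)  = <ᵇ-suc-≢ v m (bound v h) v≢m
  vanish′ : ∀ v → (v <ᵇ m) ≡ true → memB v ℓ ≡ false → g v ≡ 0
  vanish′ v v<m = vanish v (<ᵇ-step v m v<m)

-- Counting sortable continuations by the shape of the stack

-- A stack is stored as its maximal runs: (b , c) is a run of c + 1 copies of sock b.
Block : Set
Block = Sock × ℕ

unblock : List Block → SockSeq
unblock []             = []
unblock ((b , c) ∷ bl) = b ∷ (replicate c b ++ unblock bl)

blockSocks : List Block → SockSeq
blockSocks = map proj₁

unblock-++ : ∀ xs ys → unblock (xs ++ ys) ≡ unblock xs ++ unblock ys
unblock-++ []             ys = refl
unblock-++ ((b , c) ∷ xs) ys =
  cong (b ∷_) (trans (cong (replicate c b ++_) (unblock-++ xs ys)) (sym (++-assoc (replicate c b) (unblock xs) (unblock ys))))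

memB-replicate-≢ : ∀ a c b l → ¬ a ≡ b → memB a (replicate c b ++ l) ≡ memB a l
memB-replicate-≢ a zero    b l _   = refl
memB-replicate-≢ a (suc c) b l a≢b rewrite ≢⇒≡ᵇ-false a b a≢b = memB-replicate-≢ a c b l a≢b

memB-unblock : ∀ a bl → memB a (unblock bl) ≡ memB a (blockSocks bl)
memB-unblock a []             = refl
memB-unblock a ((b , c) ∷ bl) with ≡ᵇ-cases a b
... | inj₁ (_ , refl) rewrite ≡ᵇ-refl a = refl
... | inj₂ (e , a≢b)  rewrite e = trans (memB-replicate-≢ a c b (unblock bl) a≢b) (memB-unblock a bl)

abaAfter-replicate : ∀ x c l → abaAfter x (replicate c x ++ l) ≡ abaAfter x l
abaAfter-replicate x zero    l = refl
abaAfter-replicate x (suc c) l rewrite ≡ᵇ-refl x = abaAfter-replicate x c l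

push-fresh-ok : ∀ x st → memB x st ≡ false → containsABA st ≡ false → containsABA (x ∷ st) ≡ false
push-fresh-ok x st x∉ ok = trans (containsABA-∷ x st) (cong₂ _∨_ (abaAfter-∉ x st x∉) ok)

push-top-ok : ∀ x c bl → memB x (blockSocks bl) ≡ false → containsABA (unblock ((x , c) ∷ bl)) ≡ false →
              containsABA (x ∷ unblock ((x , c) ∷ bl)) ≡ false
push-top-ok x c bl x∉ ok = trans (containsABA-∷ x (unblock ((x , c) ∷ bl))) (cong₂ _∨_ no-return ok)
  where
  no-return : abaAfter x (x ∷ (replicate c x ++ unblock bl)) ≡ false
  no-return rewrite ≡ᵇ-refl x =
    trans (abaAfter-replicate x c (unblock bl)) (abaAfter-∉ x (unblock bl) (trans (memB-unblock x bl) x∉))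

finish-pop-all : ∀ v w l rest out → memB v l ≡ false → memB v rest ≡ true →
                 finish (v ∷ w) (l ++ rest) out ≡ finish (v ∷ w) rest (out ++ l)
finish-pop-all v w []      rest out _  _ = cong (finish (v ∷ w) rest) (sym (++-identityʳ out))
finish-pop-all v w (b ∷ l) rest out v∉ v∈ with ≡ᵇ-cases v b
... | inj₁ (_ , refl) = ⊥-elim (true≢false (memB-here v l) v∉)
... | inj₂ (_ , v≢b)  = begin
    finish (v ∷ w) (b ∷ l ++ rest) out         ≡⟨ finish-pop v w b (l ++ rest) out blocked ⟩
    finish (v ∷ w) (l ++ rest) (out ++ [ b ])  ≡⟨ finish-pop-all v w l rest (out ++ [ b ]) (trans (sym (memB-∷-≢ v b l v≢b)) v∉) v∈ ⟩
    finish (v ∷ w) rest ((out ++ [ b ]) ++ l)  ≡⟨ cong (finish (v ∷ w) rest) (++-assoc out [ b ] l) ⟩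
    finish (v ∷ w) rest (out ++ b ∷ l)         ∎
  where
  open ≡-Reasoning
  blocked : containsABA (v ∷ b ∷ l ++ rest) ≡ true
  blocked = containsABA-here v (b ∷ l ++ rest)
              (trans (abaAfter-∷-≢ v b (l ++ rest) v≢b) (memB-++⁺ʳ v l rest v∈))

-- runs k f : the stack has k runs and none of its socks has been output; f records
--   whether the output is nonempty.
-- reopened k : the top run consists of the last output sock, pushed back onto the
--   stack, above k runs of socks not yet output.
data Shape : Set where
  runs     : ℕ → Bool → Shape
  reopened : ℕ → Shape

sumOneTo : (ℕ → ℕ) → ℕ → ℕ
sumOneTo g zero    = 0
sumOneTo g (suc j) = g (suc j) + sumOneTo g j

shiftQ : (ℕ → ℕ) → ℕ → ℕ
shiftQ h zero    = 0
shiftQ h (suc r) = h r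

-- completions n σ r counts the ways to read n more socks from shape σ, using r new
-- socks, so that the final output is sorted. The next sock either repeats the top
-- run, lands in a deeper run (popping everything above it), reopens the last output
-- sock, or is new.
completions : ℕ → Shape → ℕ → ℕ
completions zero    σ              r = if r ≡ᵇ 0 then 1 else 0
completions (suc n) (runs k f)     r =
  ((completions n (runs k f) r + sumOneTo (λ j → completions n (runs j true) r) (k ∸ 1))
    + (if f then completions n (reopened k) r else 0))
  + shiftQ (completions n (runs (suc k) f)) r
completions (suc n) (reopened k)   r =
  completions n (reopened k) r + sumOneTo (λ j → completions n (runs j true) r) k

Good : SockSeq → SockSeq → SockSeq → ℕ → SockSeq → Bool
Good u st out R w = isSorted (finish w st out) ∧ (nDistinct (u ++ w) ≡ᵇ R)

nGood : ℕ → SockSeq → SockSeq → SockSeq → ℕ → ℕ → ℕ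
nGood n u st out m R = countWhere (Good u st out R) (rgsAux n m)

nextBound : ℕ → ℕ → ℕ
nextBound v m = if v ≡ᵇ m then suc m else m

nGoodFrom : ℕ → SockSeq → SockSeq → SockSeq → ℕ → ℕ → Sock → ℕ
nGoodFrom n u st out m R v = countWhere (λ w → Good u st out R (v ∷ w)) (rgsAux n (nextBound v m))

nGood-suc : ∀ n u st out m R →
            nGood (suc n) u st out m R ≡ sum (map (nGoodFrom n u st out m R) (upTo m)) + nGoodFrom n u st out m R m
nGood-suc n u st out m R = begin
    nGood (suc n) u st out m R
  ≡⟨ countWhere-concatMap (Good u st out R) (λ v → map (v ∷_) (rgsAux n (nextBound v m))) (upTo (suc m)) ⟩
    sum (map (λ v → countWhere (Good u st out R) (map (v ∷_) (rgsAux n (nextBound v m)))) (upTo (suc m)))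
  ≡⟨ cong sum (map-cong (λ v → countWhere-map-∷ (Good u st out R) v (rgsAux n (nextBound v m))) (upTo (suc m))) ⟩
    sum (map (nGoodFrom n u st out m R) (upTo (suc m)))
  ≡⟨ sum-upTo-snoc (nGoodFrom n u st out m R) m ⟩
    sum (map (nGoodFrom n u st out m R) (upTo m)) + nGoodFrom n u st out m R m
  ∎
  where open ≡-Reasoning

nGood-blocked : ∀ n u st out m R → containsABA (out ++ st) ≡ true → nGood n u st out m R ≡ 0
nGood-blocked n u st out m R aba = countWhere-none (Good u st out R) (rgsAux n m) unsorted
  where
  unsorted : ∀ w → Good u st out R w ≡ false
  unsorted w rewrite finish-keeps-aba w st out aba = refl

nGood-too-many : ∀ n u st out m R → R < nDistinct u → nGood n u st out m R ≡ 0
nGood-too-many n u st out m R R<u = countWhere-none (Good u st out R) (rgsAux n m) wrong-count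
  where
  >⇒≡ᵇ-false : ∀ a b → b < a → (a ≡ᵇ b) ≡ false
  >⇒≡ᵇ-false a b b<a = ≢⇒≡ᵇ-false a b (λ { refl → <-irrefl refl b<a })
  wrong-count : ∀ w → Good u st out R w ≡ false
  wrong-count w rewrite >⇒≡ᵇ-false (nDistinct (u ++ w)) R (≤-trans R<u (nDistinct-mono u w)) = ∧-zeroʳ _

nGood-zero : ∀ u st out m r → containsABA (out ++ st) ≡ false → nDistinct u ≡ m →
             nGood zero u st out m (m + r) ≡ (if r ≡ᵇ 0 then 1 else 0)
nGood-zero u st out m r ok u-count = trans (countWhere-∷ (Good u st out (m + r)) [] []) (trans (+-identityʳ _) verdict)
  where
  m≡ᵇm+r : ∀ m r → (m ≡ᵇ (m + r)) ≡ (r ≡ᵇ 0)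
  m≡ᵇm+r zero    zero    = refl
  m≡ᵇm+r zero    (suc r) = refl
  m≡ᵇm+r (suc m) r       = m≡ᵇm+r m r
  verdict : (if Good u st out (m + r) [] then 1 else 0) ≡ (if r ≡ᵇ 0 then 1 else 0)
  verdict rewrite finish-[] st out | ok | ++-identityʳ u | u-count | m≡ᵇm+r m r = refl

nGoodFrom-feed : ∀ n u st out m R v st′ out′ m′ → nextBound v m ≡ m′ →
                 (∀ w → finish (v ∷ w) st out ≡ finish w st′ out′) →
                 nGoodFrom n u st out m R v ≡ nGood n (u ++ [ v ]) st′ out′ m′ R
nGoodFrom-feed n u st out m R v st′ out′ m′ refl feed =
  countWhere-cong (rgsAux n _) (λ w → cong₂ (λ a b → isSorted a ∧ (nDistinct b ≡ᵇ R)) (feed w) (sym (++-assoc u [ v ] w)))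

NoDup-head : ∀ {y ys} → NoDup (y ∷ ys) → memB y ys ≡ false
NoDup-head (y∉ ∷ _) = y∉

NoDup-++⁻ʳ : ∀ xs ys → NoDup (xs ++ ys) → NoDup ys
NoDup-++⁻ʳ []       ys nd         = nd
NoDup-++⁻ʳ (x ∷ xs) ys (_ ∷ nd)  = NoDup-++⁻ʳ xs ys nd

NoDup-++-disjoint : ∀ a xs ys → NoDup (xs ++ ys) → memB a ys ≡ true → memB a xs ≡ false
NoDup-++-disjoint a []       ys _          _  = refl
NoDup-++-disjoint a (x ∷ xs) ys (x∉ ∷ nd) a∈ with ≡ᵇ-cases a x
... | inj₁ (_ , refl) = ⊥-elim (true≢false (memB-++⁺ʳ a xs ys a∈) x∉)
... | inj₂ (_ , a≢x)  = trans (memB-∷-≢ a x xs a≢x) (NoDup-++-disjoint a xs ys nd a∈)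

NoDup-∷ʳ : ∀ xs L → NoDup xs → memB L xs ≡ false → NoDup (xs ++ [ L ])
NoDup-∷ʳ []       L []          _  = refl ∷ []
NoDup-∷ʳ (x ∷ xs) L (x∉ ∷ nd) L∉ with ≡ᵇ-cases L x
... | inj₁ (_ , refl) = ⊥-elim (true≢false (memB-here L xs) L∉)
... | inj₂ (_ , L≢x)  = x∉′ ∷ NoDup-∷ʳ xs L nd (trans (sym (memB-∷-≢ L x xs L≢x)) L∉)
  where
  x∉′ : memB x (xs ++ [ L ]) ≡ false
  x∉′ = trans (memB-++ x xs [ L ]) (cong₂ _∨_ x∉ (trans (memB-singleton x L) (≢⇒≡ᵇ-false x L (L≢x ∘ sym))))

read-old : ∀ u m v → (v <ᵇ m) ≡ true → (∀ x → memB x u ≡ (x <ᵇ m)) → ∀ x → memB x (u ++ [ v ]) ≡ (x <ᵇ m)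
read-old u m v v<m read x = trans (memB-++ x u [ v ]) (trans (cong₂ _∨_ (read x) (memB-singleton x v)) (absorb (≡ᵇ-cases x v)))
  where
  absorb : ((x ≡ᵇ v) ≡ true × x ≡ v) ⊎ ((x ≡ᵇ v) ≡ false × ¬ x ≡ v) → ((x <ᵇ m) ∨ (x ≡ᵇ v)) ≡ (x <ᵇ m)
  absorb (inj₁ (e , refl)) rewrite e | v<m = refl
  absorb (inj₂ (e , _))    rewrite e = ∨-identityʳ _

read-new : ∀ u m → (∀ x → memB x u ≡ (x <ᵇ m)) → ∀ x → memB x (u ++ [ m ]) ≡ (x <ᵇ suc m)
read-new u m read x = trans (memB-++ x u [ m ]) (trans (cong₂ _∨_ (read x) (memB-singleton x m)) (sym (<ᵇ-suc x m)))

nDistinct-read-old : ∀ u m v → (v <ᵇ m) ≡ true → (∀ x → memB x u ≡ (x <ᵇ m)) → nDistinct u ≡ m → nDistinct (u ++ [ v ]) ≡ m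
nDistinct-read-old u m v v<m read count rewrite nDistinct-∷ʳ u v | read v | v<m = count

nDistinct-read-new : ∀ u m → (∀ x → memB x u ≡ (x <ᵇ m)) → nDistinct u ≡ m → nDistinct (u ++ [ m ]) ≡ suc m
nDistinct-read-new u m read count rewrite nDistinct-∷ʳ u m | read m | <ᵇ-irrefl m = cong suc count

record Invariant (u : SockSeq) (bl : List Block) (out : SockSeq) (m : ℕ) : Set where
  field
    read-socks    : ∀ x → memB x u ≡ (x <ᵇ m)
    read-distinct : nDistinct u ≡ m
    alive         : containsABA (out ++ unblock bl) ≡ false
    runs-distinct : NoDup (blockSocks bl)
    cover         : ∀ x → (x <ᵇ m) ≡ true → memB x out ≡ false → memB x (blockSocks bl) ≡ true
    out-bound     : ∀ x → memB x out ≡ true → (x <ᵇ m) ≡ true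
    stack-bound   : ∀ x → memB x (blockSocks bl) ≡ true → (x <ᵇ m) ≡ true

Disjoint : List Block → SockSeq → Set
Disjoint bl out = ∀ x → memB x (blockSocks bl) ≡ true → memB x out ≡ false

Disjoint-∉ : ∀ {bl out} → Disjoint bl out → ∀ a → memB a out ≡ true → memB a (blockSocks bl) ≡ false
Disjoint-∉ disj a a∈out = contraposeᵇ (λ a∈bl → ⊥-elim (true≢false a∈out (disj a a∈bl))) refl

data OutputFlag : Bool → SockSeq → Set where
  empty    : OutputFlag false []
  nonempty : ∀ o L → OutputFlag true (o ++ [ L ])

OutputFlag-nonempty : ∀ out y ys → OutputFlag true (out ++ y ∷ ys)
OutputFlag-nonempty out y []       = nonempty out y
OutputFlag-nonempty out y (z ∷ zs) = subst (OutputFlag true) (++-assoc out [ y ] (z ∷ zs)) (OutputFlag-nonempty (out ++ [ y ]) z zs)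

module _ {u b c bl out m} (I : Invariant u ((b , c) ∷ bl) out m) where
  open Invariant I

  top<m : (b <ᵇ m) ≡ true
  top<m = stack-bound b (memB-here b (blockSocks bl))

  Invariant-repeat : Invariant (u ++ [ b ]) ((b , suc c) ∷ bl) out m
  Invariant-repeat = record
    { read-socks    = read-old u m b top<m read-socks
    ; read-distinct = nDistinct-read-old u m b top<m read-socks read-distinct
    ; alive         = trans (containsABA-dup out b (replicate c b ++ unblock bl)) alive
    ; runs-distinct = runs-distinct
    ; cover         = cover
    ; out-bound     = out-bound
    ; stack-bound   = stack-bound
    }

  feed-repeat : ∀ w → finish (b ∷ w) (unblock ((b , c) ∷ bl)) out ≡ finish w (unblock ((b , suc c) ∷ bl)) out
  feed-repeat w =
    finish-push b w _ out (push-top-ok b c bl (NoDup-head runs-distinct) (contraposeᵇ (containsABA-++⁺ʳ out _) alive))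

module _ {u bl out m} (I : Invariant u bl out m) where
  open Invariant I

  new∉out : memB m out ≡ false
  new∉out = ∉-bound m out out-bound

  new∉stack : memB m (blockSocks bl) ≡ false
  new∉stack = ∉-bound m (blockSocks bl) stack-bound

  Invariant-new : Disjoint bl out → Invariant (u ++ [ m ]) ((m , 0) ∷ bl) out (suc m)
  Invariant-new disj = record
    { read-socks    = read-new u m read-socks
    ; read-distinct = nDistinct-read-new u m read-socks read-distinct
    ; alive         = alive′
    ; runs-distinct = new∉stack ∷ runs-distinct
    ; cover         = cover′
    ; out-bound     = λ x x∈ → <ᵇ-step x m (out-bound x x∈)
    ; stack-bound   = stack-bound′
    }
    where
    alive′ : containsABA (out ++ m ∷ unblock bl) ≡ false
    alive′ = trans (containsABA-++-disjoint out (m ∷ unblock bl) out∉stack)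
               (cong₂ _∨_ (contraposeᵇ (containsABA-++⁺ˡ out (unblock bl)) alive)
                          (push-fresh-ok m (unblock bl) (trans (memB-unblock m bl) new∉stack)
                                          (contraposeᵇ (containsABA-++⁺ʳ out (unblock bl)) alive)))
      where
      out∉stack : ∀ a → memB a out ≡ true → memB a (m ∷ unblock bl) ≡ false
      out∉stack a a∈ = trans (memB-∷-≢ a m (unblock bl) (<ᵇ⇒≢ a m (out-bound a a∈)))
                         (trans (memB-unblock a bl) (Disjoint-∉ {bl} {out} disj a a∈))
    cover′ : ∀ x → (x <ᵇ suc m) ≡ true → memB x out ≡ false → memB x (m ∷ blockSocks bl) ≡ true
    cover′ x x<m′ x∉ with ≡ᵇ-cases x m
    ... | inj₁ (_ , refl) = memB-here x (blockSocks bl)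
    ... | inj₂ (_ , x≢m)  = trans (memB-∷-≢ x m (blockSocks bl) x≢m) (cover x (<ᵇ-suc-≢ x m x<m′ x≢m) x∉)
    stack-bound′ : ∀ x → memB x (m ∷ blockSocks bl) ≡ true → (x <ᵇ suc m) ≡ true
    stack-bound′ x x∈ with memB-∷⁻ x m (blockSocks bl) x∈
    ... | inj₁ refl = <ᵇ-self x
    ... | inj₂ x∈bl = <ᵇ-step x m (stack-bound x x∈bl)

feed-fresh : ∀ v bl out → containsABA (out ++ unblock bl) ≡ false → memB v (blockSocks bl) ≡ false →
             ∀ w → finish (v ∷ w) (unblock bl) out ≡ finish w (v ∷ unblock bl) out
feed-fresh v bl out alive v∉ w =
  finish-push v w (unblock bl) out
    (push-fresh-ok v (unblock bl) (trans (memB-unblock v bl) v∉) (contraposeᵇ (containsABA-++⁺ʳ out _) alive))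

Invariant-reopen : ∀ {u bl o L m} → Invariant u bl (o ++ [ L ]) m → memB L (blockSocks bl) ≡ false →
                   Invariant (u ++ [ L ]) ((L , 0) ∷ bl) (o ++ [ L ]) m
Invariant-reopen {u} {bl} {o} {L} {m} I L∉ = record
  { read-socks    = read-old u m L L<m read-socks
  ; read-distinct = nDistinct-read-old u m L L<m read-socks read-distinct
  ; alive         = alive′
  ; runs-distinct = L∉ ∷ runs-distinct
  ; cover         = λ x x<m x∉ → memB-there x L (blockSocks bl) (cover x x<m x∉)
  ; out-bound     = out-bound
  ; stack-bound   = stack-bound′
  }
  where
  open Invariant I
  L<m : (L <ᵇ m) ≡ true
  L<m = out-bound L (memB-∷ʳ-last L o)
  alive′ : containsABA ((o ++ [ L ]) ++ L ∷ unblock bl) ≡ false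
  alive′ = begin
    containsABA ((o ++ [ L ]) ++ L ∷ unblock bl)   ≡⟨ cong containsABA (++-assoc o [ L ] (L ∷ unblock bl)) ⟩
    containsABA (o ++ L ∷ L ∷ unblock bl)          ≡⟨ containsABA-dup o L (unblock bl) ⟩
    containsABA (o ++ L ∷ unblock bl)              ≡⟨ cong containsABA (++-assoc o [ L ] (unblock bl)) ⟨
    containsABA ((o ++ [ L ]) ++ unblock bl)       ≡⟨ alive ⟩
    false                                          ∎
    where open ≡-Reasoning
  stack-bound′ : ∀ x → memB x (L ∷ blockSocks bl) ≡ true → (x <ᵇ m) ≡ true
  stack-bound′ x x∈ with memB-∷⁻ x L (blockSocks bl) x∈
  ... | inj₁ refl = L<m
  ... | inj₂ x∈bl = stack-bound x x∈bl

-- Reading a sock v of a deeper run pops the runs above it, p ∷ pre, to the output.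
module PopTo {u p pre v cv post out m} (I : Invariant u ((p ∷ pre) ++ (v , cv) ∷ post) out m)
             (disj : Disjoint ((v , cv) ∷ post) out) where
  open Invariant I

  above : List Block
  above = p ∷ pre

  out′ : SockSeq
  out′ = out ++ unblock above

  private
    socks-split : blockSocks (above ++ (v , cv) ∷ post) ≡ blockSocks above ++ v ∷ blockSocks post
    socks-split = map-++ proj₁ above ((v , cv) ∷ post)

    distinct-split : NoDup (blockSocks above ++ v ∷ blockSocks post)
    distinct-split = subst NoDup socks-split runs-distinct

    below⇒stack : ∀ x → memB x (v ∷ blockSocks post) ≡ true → memB x (blockSocks (above ++ (v , cv) ∷ post)) ≡ true
    below⇒stack x h = trans (cong (memB x) socks-split) (memB-++⁺ʳ x (blockSocks above) _ h)

    above⇒stack : ∀ x → memB x (blockSocks above) ≡ true → memB x (blockSocks (above ++ (v , cv) ∷ post)) ≡ true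
    above⇒stack x h = trans (cong (memB x) socks-split) (memB-++⁺ˡ x (blockSocks above) _ h)

    below∉above : ∀ x → memB x (v ∷ blockSocks post) ≡ true → memB x (blockSocks above) ≡ false
    below∉above x = NoDup-++-disjoint x (blockSocks above) _ distinct-split

    v∈below : memB v (v ∷ blockSocks post) ≡ true
    v∈below = memB-here v (blockSocks post)

    rest : SockSeq
    rest = replicate cv v ++ unblock post

    word-split : out ++ unblock (above ++ (v , cv) ∷ post) ≡ out′ ++ v ∷ rest
    word-split = trans (cong (out ++_) (unblock-++ above ((v , cv) ∷ post))) (sym (++-assoc out (unblock above) (v ∷ rest)))

    alive-split : containsABA (out′ ++ v ∷ rest) ≡ false
    alive-split = trans (cong containsABA (sym word-split)) alive

  v<m : (v <ᵇ m) ≡ true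
  v<m = stack-bound v (below⇒stack v v∈below)

  invariant : Invariant (u ++ [ v ]) ((v , suc cv) ∷ post) out′ m
  invariant = record
    { read-socks    = read-old u m v v<m read-socks
    ; read-distinct = nDistinct-read-old u m v v<m read-socks read-distinct
    ; alive         = trans (containsABA-dup out′ v rest) alive-split
    ; runs-distinct = NoDup-++⁻ʳ (blockSocks above) _ distinct-split
    ; cover         = cover′
    ; out-bound     = out-bound′
    ; stack-bound   = λ x h → stack-bound x (below⇒stack x h)
    }
    where
    cover′ : ∀ x → (x <ᵇ m) ≡ true → memB x out′ ≡ false → memB x (v ∷ blockSocks post) ≡ true
    cover′ x x<m x∉
      with memB-++⁻ x (blockSocks above) _ (trans (cong (memB x) (sym socks-split))
                                               (cover x x<m (contraposeᵇ (memB-++⁺ˡ x out _) x∉)))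
    ... | inj₂ x∈below = x∈below
    ... | inj₁ x∈above = ⊥-elim (true≢false x∈above
                           (trans (sym (memB-unblock x above)) (contraposeᵇ (memB-++⁺ʳ x out _) x∉)))
    out-bound′ : ∀ x → memB x out′ ≡ true → (x <ᵇ m) ≡ true
    out-bound′ x x∈ with memB-++⁻ x out (unblock above) x∈
    ... | inj₁ x∈out   = out-bound x x∈out
    ... | inj₂ x∈above = stack-bound x (above⇒stack x (trans (sym (memB-unblock x above)) x∈above))

  disjoint : Disjoint ((v , suc cv) ∷ post) out′
  disjoint x h = trans (memB-++ x out (unblock above))
                       (cong₂ _∨_ (disj x h) (trans (memB-unblock x above) (below∉above x h)))

  flag : OutputFlag true out′
  flag = OutputFlag-nonempty out (proj₁ p) (replicate (proj₂ p) (proj₁ p) ++ unblock pre)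

  feed : ∀ w → finish (v ∷ w) (unblock (above ++ (v , cv) ∷ post)) out ≡ finish w (unblock ((v , suc cv) ∷ post)) out′
  feed w = begin
      finish (v ∷ w) (unblock (above ++ (v , cv) ∷ post)) out
    ≡⟨ cong (λ st → finish (v ∷ w) st out) (unblock-++ above ((v , cv) ∷ post)) ⟩
      finish (v ∷ w) (unblock above ++ v ∷ rest) out
    ≡⟨ finish-pop-all v w (unblock above) (v ∷ rest) out (trans (memB-unblock v above) (below∉above v v∈below)) (memB-here v rest) ⟩
      finish (v ∷ w) (v ∷ rest) out′
    ≡⟨ finish-push v w (v ∷ rest) out′ (push-top-ok v cv post (NoDup-head (Invariant.runs-distinct invariant))
                                          (contraposeᵇ (containsABA-++⁺ʳ out′ _) alive-split)) ⟩
      finish w (v ∷ v ∷ rest) out′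
    ∎
    where open ≡-Reasoning

RunsCount : ℕ → Set
RunsCount n = ∀ f u b c bl out m → Invariant u ((b , c) ∷ bl) out m → Disjoint ((b , c) ∷ bl) out → OutputFlag f out →
              ∀ r → nGood n u (unblock ((b , c) ∷ bl)) out m (m + r) ≡ completions n (runs (suc (length bl)) f) r

ReopenedCount : ℕ → Set
ReopenedCount n = ∀ u L c bl o m → Invariant u ((L , c) ∷ bl) (o ++ [ L ]) m → Disjoint bl (o ++ [ L ]) →
                  ∀ r → nGood n u (unblock ((L , c) ∷ bl)) (o ++ [ L ]) m (m + r) ≡ completions n (reopened (length bl)) r

nextBound-old : ∀ v m → (v <ᵇ m) ≡ true → nextBound v m ≡ m
nextBound-old v m v<m rewrite ≢⇒≡ᵇ-false v m (<ᵇ⇒≢ v m v<m) = refl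

nextBound-new : ∀ m → nextBound m m ≡ suc m
nextBound-new m rewrite ≡ᵇ-refl m = refl

nGoodFrom-blocked : ∀ n u st out m R v → containsABA st ≡ false → memB v st ≡ false →
                    containsABA (out ++ v ∷ st) ≡ true → nGoodFrom n u st out m R v ≡ 0
nGoodFrom-blocked n u st out m R v ok v∉ aba =
  trans (nGoodFrom-feed n u st out m R v (v ∷ st) out (nextBound v m) refl (λ w → finish-push v w st out (push-fresh-ok v st v∉ ok)))
        (nGood-blocked n (u ++ [ v ]) (v ∷ st) out (nextBound v m) R aba)

deeper-runs : ∀ n → RunsCount n → ∀ u bl p pre post out m r → bl ≡ (p ∷ pre) ++ post →
              Invariant u bl out m → Disjoint post out →
              sum (map (nGoodFrom n u (unblock bl) out m (m + r)) (blockSocks post))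
                ≡ sumOneTo (λ j → completions n (runs j true) r) (length post)
deeper-runs n count u bl p pre []                out m r _    I disj = refl
deeper-runs n count u bl p pre ((v , cv) ∷ post) out m r refl I disj =
  cong₂ _+_ pop-to-v (deeper-runs n count u bl p (pre ++ [ (v , cv) ]) post out m r regroup I
                                  (λ x h → disj x (memB-there x v (blockSocks post) h)))
  where
  module P = PopTo I disj
  regroup : (p ∷ pre) ++ (v , cv) ∷ post ≡ (p ∷ pre ++ [ (v , cv) ]) ++ post
  regroup = cong (p ∷_) (sym (++-assoc pre [ (v , cv) ] post))
  pop-to-v : nGoodFrom n u (unblock bl) out m (m + r) v ≡ completions n (runs (suc (length post)) true) r
  pop-to-v = trans (nGoodFrom-feed n u (unblock bl) out m (m + r) v (unblock ((v , suc cv) ∷ post)) P.out′ m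
                                   (nextBound-old v m P.v<m) P.feed)
                   (count true (u ++ [ v ]) v (suc cv) post P.out′ m P.invariant P.disjoint P.flag r)

sum-upTo-stack : ∀ {u bl m} → Invariant u bl [] m → ∀ g → sum (map g (upTo m)) ≡ sum (map g (blockSocks bl))
sum-upTo-stack {bl = bl} {m} I g = sum-upTo-support m (blockSocks bl) g runs-distinct stack-bound off-stack
  where
  open Invariant I
  off-stack : ∀ v → (v <ᵇ m) ≡ true → memB v (blockSocks bl) ≡ false → g v ≡ 0
  off-stack v v<m v∉ = ⊥-elim (true≢false (cover v v<m refl) v∉)

-- Besides the stack socks, only the last output sock L can be read next: any other
-- sock already read is in o, and reading it creates v L v.
sum-upTo-reopen : ∀ n → ReopenedCount n → ∀ {u bl o L m} → Invariant u bl (o ++ [ L ]) m → Disjoint bl (o ++ [ L ]) → ∀ r →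
                  sum (map (nGoodFrom n u (unblock bl) (o ++ [ L ]) m (m + r)) (upTo m))
                    ≡ sum (map (nGoodFrom n u (unblock bl) (o ++ [ L ]) m (m + r)) (blockSocks bl))
                      + completions n (reopened (length bl)) r
sum-upTo-reopen n countO {u} {bl} {o} {L} {m} I disj r = begin
    sum (map G (upTo m))
  ≡⟨ sum-upTo-support m (blockSocks bl ++ [ L ]) G (NoDup-∷ʳ (blockSocks bl) L runs-distinct L∉stack) bound off-support ⟩
    sum (map G (blockSocks bl ++ [ L ]))
  ≡⟨ trans (cong sum (map-++ G (blockSocks bl) [ L ])) (sum-++ (map G (blockSocks bl)) [ G L ]) ⟩
    sum (map G (blockSocks bl)) + (G L + 0)
  ≡⟨ cong (sum (map G (blockSocks bl)) +_) (trans (+-identityʳ (G L)) reopen) ⟩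
    sum (map G (blockSocks bl)) + completions n (reopened (length bl)) r
  ∎
  where
  open ≡-Reasoning
  open Invariant I
  out : SockSeq
  out = o ++ [ L ]
  st : SockSeq
  st = unblock bl
  G : Sock → ℕ
  G = nGoodFrom n u st out m (m + r)
  L∉stack : memB L (blockSocks bl) ≡ false
  L∉stack = Disjoint-∉ {bl} {out} disj L (memB-∷ʳ-last L o)
  bound : ∀ v → memB v (blockSocks bl ++ [ L ]) ≡ true → (v <ᵇ m) ≡ true
  bound v h with memB-++⁻ v (blockSocks bl) [ L ] h
  ... | inj₁ v∈stack = stack-bound v v∈stack
  ... | inj₂ v∈[L] with memB-∷⁻ v L [] v∈[L]
  ...   | inj₁ refl = out-bound v (memB-∷ʳ-last v o)
  off-support : ∀ v → (v <ᵇ m) ≡ true → memB v (blockSocks bl ++ [ L ]) ≡ false → G v ≡ 0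
  off-support v v<m v∉ =
    nGoodFrom-blocked n u st out m (m + r) v (contraposeᵇ (containsABA-++⁺ʳ out st) alive) (trans (memB-unblock v bl) v∉stack) returns
    where
    v∉stack : memB v (blockSocks bl) ≡ false
    v∉stack = contraposeᵇ (memB-++⁺ˡ v (blockSocks bl) [ L ]) v∉
    L≢v : ¬ L ≡ v
    L≢v refl = true≢false (memB-++⁺ʳ v (blockSocks bl) [ v ] (memB-here v [])) v∉
    v∈out : memB v out ≡ true
    v∈out with memB v out in e
    ... | true  = refl
    ... | false = ⊥-elim (true≢false (cover v v<m e) v∉stack)
    v∈o : memB v o ≡ true
    v∈o with memB-++⁻ v o [ L ] v∈out
    ... | inj₁ v∈o = v∈o
    ... | inj₂ v∈[L] with memB-∷⁻ v L [] v∈[L]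
    ...   | inj₁ refl = ⊥-elim (L≢v refl)
    returns : containsABA (out ++ v ∷ st) ≡ true
    returns = subst (λ w → containsABA w ≡ true) (sym (++-assoc o [ L ] (v ∷ st))) (containsABA-return v o L st v∈o L≢v)
  reopen : G L ≡ completions n (reopened (length bl)) r
  reopen = trans (nGoodFrom-feed n u st out m (m + r) L (L ∷ st) out m (nextBound-old L m (out-bound L (memB-∷ʳ-last L o)))
                                 (feed-fresh L bl out alive L∉stack))
                 (countO (u ++ [ L ]) L 0 bl o m (Invariant-reopen I L∉stack) disj r)

step-runs : ∀ n → RunsCount n → ReopenedCount n → RunsCount (suc n)
step-runs n countR countO f u b c bl out m I disj flag r = begin
    nGood (suc n) u st out m (m + r)
  ≡⟨ nGood-suc n u st out m (m + r) ⟩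
    sum (map G (upTo m)) + G m
  ≡⟨ cong₂ _+_ (old-socks flag) new-sock ⟩
    ((completions n (runs k f) r + sumOneTo g (k ∸ 1)) + (if f then completions n (reopened k) r else 0))
      + shiftQ (completions n (runs (suc k) f)) r
  ∎
  where
  open ≡-Reasoning
  open Invariant I
  bl₀ : List Block
  bl₀ = (b , c) ∷ bl
  st : SockSeq
  st = unblock bl₀
  k : ℕ
  k = suc (length bl)
  G : Sock → ℕ
  G = nGoodFrom n u st out m (m + r)
  g : ℕ → ℕ
  g j = completions n (runs j true) r

  repeat-top : G b ≡ completions n (runs k f) r
  repeat-top = trans (nGoodFrom-feed n u st out m (m + r) b (unblock ((b , suc c) ∷ bl)) out m (nextBound-old b m (top<m I)) (feed-repeat I))
                     (countR f (u ++ [ b ]) b (suc c) bl out m (Invariant-repeat I) disj flag r)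

  stack-socks : sum (map G (blockSocks bl₀)) ≡ completions n (runs k f) r + sumOneTo g (length bl)
  stack-socks = cong₂ _+_ repeat-top
    (deeper-runs n countR u bl₀ (b , c) [] bl out m r refl I (λ x h → disj x (memB-there x b (blockSocks bl) h)))

  new-sock : G m ≡ shiftQ (completions n (runs (suc k) f)) r
  new-sock = trans (nGoodFrom-feed n u st out m (m + r) m (m ∷ st) out (suc m) (nextBound-new m) (feed-fresh m bl₀ out alive (new∉stack I)))
                   (pushed r)
    where
    disj′ : Disjoint ((m , 0) ∷ bl₀) out
    disj′ x h with memB-∷⁻ x m (blockSocks bl₀) h
    ... | inj₁ refl = new∉out I
    ... | inj₂ x∈   = disj x x∈
    pushed : ∀ r → nGood n (u ++ [ m ]) (m ∷ st) out (suc m) (m + r) ≡ shiftQ (completions n (runs (suc k) f)) r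
    pushed zero    = nGood-too-many n (u ++ [ m ]) (m ∷ st) out (suc m) (m + 0)
                       (subst ((m + 0) <_) (sym (nDistinct-read-new u m read-socks read-distinct)) (s≤s (≤-reflexive (+-identityʳ m))))
    pushed (suc r) = trans (cong (nGood n (u ++ [ m ]) (m ∷ st) out (suc m)) (+-suc m r))
                           (countR f (u ++ [ m ]) m 0 bl₀ out (suc m) (Invariant-new I disj) disj′ flag r)

  old-socks : OutputFlag f out →
              sum (map G (upTo m)) ≡ (completions n (runs k f) r + sumOneTo g (k ∸ 1)) + (if f then completions n (reopened k) r else 0)
  old-socks empty          = trans (sum-upTo-stack I G) (trans stack-socks (sym (+-identityʳ _)))
  old-socks (nonempty o L) = trans (sum-upTo-reopen n countO I disj r) (cong (_+ completions n (reopened k) r) stack-socks)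

step-reopened : ∀ n → RunsCount n → ReopenedCount n → ReopenedCount (suc n)
step-reopened n countR countO u L c bl o m I disj r = begin
    nGood (suc n) u st out m (m + r)
  ≡⟨ nGood-suc n u st out m (m + r) ⟩
    sum (map G (upTo m)) + G m
  ≡⟨ cong₂ _+_ (sum-upTo-support m (blockSocks bl₀) G runs-distinct stack-bound off-stack) new-sock ⟩
    (G L + sum (map G (blockSocks bl))) + 0
  ≡⟨ trans (+-identityʳ _) (cong₂ _+_ repeat-top (deeper-runs n countR u bl₀ (L , c) [] bl out m r refl I disj)) ⟩
    completions n (reopened (length bl)) r + sumOneTo (λ j → completions n (runs j true) r) (length bl)
  ∎
  where
  open ≡-Reasoning
  open Invariant I
  bl₀ : List Block
  bl₀ = (L , c) ∷ bl
  out : SockSeq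
  out = o ++ [ L ]
  st : SockSeq
  st = unblock bl₀
  G : Sock → ℕ
  G = nGoodFrom n u st out m (m + r)

  repeat-top : G L ≡ completions n (reopened (length bl)) r
  repeat-top = trans (nGoodFrom-feed n u st out m (m + r) L (unblock ((L , suc c) ∷ bl)) out m (nextBound-old L m (top<m I)) (feed-repeat I))
                     (countO (u ++ [ L ]) L (suc c) bl o m (Invariant-repeat I) disj r)

  returns : ∀ v → ¬ v ≡ L → containsABA (out ++ v ∷ st) ≡ true
  returns v v≢L = containsABA-return L out v (replicate c L ++ unblock bl) (memB-∷ʳ-last L o) v≢L

  blocked : ∀ v → memB v (blockSocks bl₀) ≡ false → ¬ v ≡ L → G v ≡ 0
  blocked v v∉ v≢L = nGoodFrom-blocked n u st out m (m + r) v (contraposeᵇ (containsABA-++⁺ʳ out st) alive)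
                       (trans (memB-unblock v bl₀) v∉) (returns v v≢L)

  off-stack : ∀ v → (v <ᵇ m) ≡ true → memB v (blockSocks bl₀) ≡ false → G v ≡ 0
  off-stack v _ v∉ = blocked v v∉ (λ { refl → true≢false (memB-here v (blockSocks bl)) v∉ })

  new-sock : G m ≡ 0
  new-sock = blocked m (new∉stack I) (λ { refl → <ᵇ⇒≢ L m (top<m I) refl })

mutual
  runs-count : ∀ n → RunsCount n
  runs-count zero    f u b c bl out m I _    _    r = nGood-zero u _ out m r (Invariant.alive I) (Invariant.read-distinct I)
  runs-count (suc n) = step-runs n (runs-count n) (reopened-count n)

  reopened-count : ∀ n → ReopenedCount n
  reopened-count zero    u L c bl o m I _ r = nGood-zero u _ (o ++ [ L ]) m r (Invariant.alive I) (Invariant.read-distinct I)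
  reopened-count (suc n) = step-reopened n (runs-count n) (reopened-count n)

initial : Invariant [ 0 ] [ (0 , 0) ] [] 1
initial = record
  { read-socks    = λ { zero → refl ; (suc x) → refl }
  ; read-distinct = refl
  ; alive         = refl
  ; runs-distinct = refl ∷ []
  ; cover         = λ { zero _ _ → refl ; (suc x) () _ }
  ; out-bound     = λ x ()
  ; stack-bound   = λ { zero _ → refl ; (suc x) () }
  }

s≡completions : ∀ n r → s (suc n) (suc r) ≡ completions n (runs 1 false) r
s≡completions n r = begin
    s (suc n) (suc r)
  ≡⟨ countWhere-concatMap Sortable (λ v → map (v ∷_) (rgsAux n (nextBound v 0))) (upTo 1) ⟩
    countWhere Sortable (map (0 ∷_) (rgsAux n 1)) + 0
  ≡⟨ trans (+-identityʳ _) (countWhere-map-∷ Sortable 0 (rgsAux n 1)) ⟩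
    countWhere (λ w → Sortable (0 ∷ w)) (rgsAux n 1)
  ≡⟨ countWhere-cong (rgsAux n 1) first-pushed ⟩
    nGood n [ 0 ] [ 0 ] [] 1 (1 + r)
  ≡⟨ runs-count n false [ 0 ] 0 0 [] [] 1 initial (λ _ _ → refl) empty r ⟩
    completions n (runs 1 false) r
  ∎
  where
  open ≡-Reasoning
  Sortable : SockSeq → Bool
  Sortable p = stackSortable p ∧ (distinctSocks p ≡ᵇ suc r)
  first-pushed : ∀ w → Sortable (0 ∷ w) ≡ Good [ 0 ] [ 0 ] [] (1 + r) w
  first-pushed w = cong₂ (λ a b → isSorted a ∧ (b ≡ᵇ suc r))
                         (trans (φaba≡finish (0 ∷ w)) (finish-push 0 w [] [] refl)) (distinctSocks≡nDistinct (0 ∷ w))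

-- Imported only here: the constructor +_ makes sections such as (n +_) above ambiguous.
open import Data.Integer as ℤ using (ℤ; +_; -[1+_])
import Data.Integer.Properties as ℤᵖ
open import Data.Maybe using (Maybe; just; nothing)

module InQ = PowerSeries ℤᵖ.+-*-commutativeRing
module InX = PowerSeries InQ.seriesRing
module Raw = CommutativeRing InX.seriesRing

-- Opaque operations keep the ring solver from unfolding series products.
opaque
  _⊞_ : Ser → Ser → Ser
  (F ⊞ G) n r = F n r ℤ.+ G n r

  _⊠_ : Ser → Ser → Ser
  _⊠_ = InX.conv

  ⊟_ : Ser → Ser
  (⊟ F) n r = ℤ.- F n r

infixl 6 _⊞_
infixl 7 _⊠_
infix  8 ⊟_

⟦_⟧ : ℤ → Ser
⟦ a ⟧ = InX.const (InQ.const a)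

opaque
  unfolding _⊞_ _⊠_ ⊟_

  ⊞-isCommutativeRing : IsCommutativeRing Raw._≈_ _⊞_ _⊠_ ⊟_ Raw.0# Raw.1#
  ⊞-isCommutativeRing = Raw.isCommutativeRing

  ⊞-coeff : ∀ F G n r → (F ⊞ G) n r ≡ F n r ℤ.+ G n r
  ⊞-coeff F G n r = refl

  ⊟-coeff : ∀ F n r → (⊟ F) n r ≡ ℤ.- F n r
  ⊟-coeff F n r = refl

  ⊠-coeff : ∀ F G n r → (F ⊠ G) n r ≡ InX.conv F G n r
  ⊠-coeff F G n r = refl

  ⟦⟧-+ : ∀ a b → Raw._≈_ ⟦ a ℤ.+ b ⟧ (⟦ a ⟧ ⊞ ⟦ b ⟧)
  ⟦⟧-+ a b = Raw.trans (InX.const-cong (InQ.const-+ a b)) (InX.const-+ (InQ.const a) (InQ.const b))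

  ⟦⟧-* : ∀ a b → Raw._≈_ ⟦ a ℤ.* b ⟧ (⟦ a ⟧ ⊠ ⟦ b ⟧)
  ⟦⟧-* a b = Raw.trans (InX.const-cong (InQ.const-* a b)) (InX.const-* (InQ.const a) (InQ.const b))

  ⟦⟧-‿ : ∀ a → Raw._≈_ ⟦ ℤ.- a ⟧ (⊟ ⟦ a ⟧)
  ⟦⟧-‿ a = Raw.trans (InX.const-cong (InQ.const-‿ a)) (InX.const-‿ (InQ.const a))

𝕊 : CommutativeRing _ _
𝕊 = record
  { Carrier           = Ser
  ; _≈_               = Raw._≈_
  ; _+_               = _⊞_
  ; _*_               = _⊠_
  ; -_                = ⊟_
  ; 0#                = Raw.0#
  ; 1#                = Raw.1#
  ; isCommutativeRing = ⊞-isCommutativeRing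
  }

open CommutativeRing 𝕊 using (_≈_) renaming (0# to 𝟘; 1# to 𝟙)
module 𝕊 = CommutativeRing 𝕊

⟦0⟧-coeff : ∀ n r → ⟦ + 0 ⟧ n r ≡ + 0
⟦0⟧-coeff zero    zero    = refl
⟦0⟧-coeff zero    (suc r) = refl
⟦0⟧-coeff (suc n) r       = refl

ℤ→𝕊 : CommutativeRing.rawRing ℤᵖ.+-*-commutativeRing -Raw-AlmostCommutative⟶ fromCommutativeRing 𝕊
ℤ→𝕊 = record
  { ⟦_⟧    = ⟦_⟧
  ; +-homo = ⟦⟧-+
  ; *-homo = ⟦⟧-*
  ; -‿homo = ⟦⟧-‿
  ; 0-homo = ⟦0⟧-coeff
  ; 1-homo = 𝕊.refl
  }

⟦⟧-≟ : ∀ a b → Maybe (⟦ a ⟧ ≈ ⟦ b ⟧)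
⟦⟧-≟ a b with a ℤ.≟ b
... | yes refl = just 𝕊.refl
... | no _     = nothing

module Solver = RingSolver (CommutativeRing.rawRing ℤᵖ.+-*-commutativeRing) (fromCommutativeRing 𝕊) ℤ→𝕊 ⟦⟧-≟

sumTo≡sumBelow : ∀ n (h : ℕ → ℤ) → sumTo n h ≡ InQ.sumBelow h (suc n)
sumTo≡sumBelow n h = go h (λ i → i) (suc n)
  where
  go : ∀ (h : ℕ → ℤ) (f : ℕ → ℕ) k → foldr (λ i acc → h i ℤ.+ acc) (+ 0) (applyUpTo f k) ≡ InQ.sumBelow (λ i → h (f i)) k
  go h f zero    = refl
  go h f (suc k) = cong (λ z → h (f 0) ℤ.+ z) (go h (λ i → f (suc i)) k)

sumBelow-coeff : ∀ (H : ℕ → ℕ → ℤ) k r → InX.sumBelow H k r ≡ InQ.sumBelow (λ i → H i r) k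
sumBelow-coeff H zero    r = refl
sumBelow-coeff H (suc k) r = cong (λ z → H 0 r ℤ.+ z) (sumBelow-coeff (λ i → H (suc i)) k r)

⊛≡⊠ : ∀ F G n r → (F ⊛ G) n r ≡ (F ⊠ G) n r
⊛≡⊠ F G n r = begin
    sumTo n (λ i → sumTo r (λ j → F i j ℤ.* G (n ∸ i) (r ∸ j)))
  ≡⟨ sumTo≡sumBelow n (λ i → sumTo r (λ j → F i j ℤ.* G (n ∸ i) (r ∸ j))) ⟩
    InQ.sumBelow (λ i → sumTo r (λ j → F i j ℤ.* G (n ∸ i) (r ∸ j))) (suc n)
  ≡⟨ InQ.sumBelow-cong _ _ (suc n) (λ i → sumTo≡sumBelow r (λ j → F i j ℤ.* G (n ∸ i) (r ∸ j))) ⟩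
    InQ.sumBelow (λ i → InQ.conv (F i) (G (n ∸ i)) r) (suc n)
  ≡⟨ sumBelow-coeff (λ i → InQ.conv (F i) (G (n ∸ i))) (suc n) r ⟨
    InX.conv F G n r
  ≡⟨ ⊠-coeff F G n r ⟨
    (F ⊠ G) n r
  ∎
  where open ≡-Reasoning

X : Ser
X = InX.var

Q : Ser
Q = InX.const InQ.var

X⊠-zero : ∀ H r → (X ⊠ H) 0 r ≡ + 0
X⊠-zero H r = trans (⊠-coeff X H 0 r) (InX.conv-var-zero H r)

X⊠-suc : ∀ H n r → (X ⊠ H) (suc n) r ≡ H n r
X⊠-suc H n r = trans (⊠-coeff X H (suc n) r) (InX.conv-var-suc H n r)

Q⊠-coeff : ∀ H n r → (Q ⊠ H) n r ≡ InQ.conv InQ.var (H n) r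
Q⊠-coeff H n r = trans (⊠-coeff Q H n r) (InX.conv-const InQ.var H n r)

Q⊠-zero : ∀ H n → (Q ⊠ H) n 0 ≡ + 0
Q⊠-zero H n = trans (Q⊠-coeff H n 0) (InQ.conv-var-zero (H n))

Q⊠-suc : ∀ H n r → (Q ⊠ H) n (suc r) ≡ H n r
Q⊠-suc H n r = trans (Q⊠-coeff H n (suc r)) (InQ.conv-var-suc (H n) r)

-- The generating functions and their equations

Runs : ℕ → Bool → Ser
Runs k f n r = + completions n (runs k f) r

Reopened : ℕ → Ser
Reopened k n r = + completions n (reopened k) r

-- The empty cases are ⟦ + 0 ⟧ rather than 𝟘: the ring solver writes the constant 0
-- as ⟦ + 0 ⟧, and the identities below must match these terms syntactically.
RunsUpTo : ℕ → Ser
RunsUpTo zero    = ⟦ + 0 ⟧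
RunsUpTo (suc j) = Runs (suc j) true ⊞ RunsUpTo j

Reopen : Bool → ℕ → Ser
Reopen true  k = Reopened k
Reopen false k = ⟦ + 0 ⟧

RunsUpTo-coeff : ∀ j n r → RunsUpTo j n r ≡ + sumOneTo (λ i → completions n (runs i true) r) j
RunsUpTo-coeff zero    n r = ⟦0⟧-coeff n r
RunsUpTo-coeff (suc j) n r = trans (⊞-coeff (Runs (suc j) true) (RunsUpTo j) n r)
                                   (cong (λ z → + completions n (runs (suc j) true) r ℤ.+ z) (RunsUpTo-coeff j n r))

Reopen-coeff : ∀ f k n r → Reopen f k n r ≡ + (if f then completions n (reopened k) r else 0)
Reopen-coeff true  k n r = refl
Reopen-coeff false k n r = ⟦0⟧-coeff n r

≈𝟙⊞X⊠ : ∀ G H → (∀ r → G 0 r ≡ 𝟙 0 r) → (∀ n r → G (suc n) r ≡ H n r) → G ≈ 𝟙 ⊞ X ⊠ H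
≈𝟙⊞X⊠ G H G₀ G₊ zero    r = begin
    G 0 r                       ≡⟨ G₀ r ⟩
    𝟙 0 r                       ≡⟨ ℤᵖ.+-identityʳ (𝟙 0 r) ⟨
    𝟙 0 r ℤ.+ + 0               ≡⟨ cong (λ z → 𝟙 0 r ℤ.+ z) (X⊠-zero H r) ⟨
    𝟙 0 r ℤ.+ (X ⊠ H) 0 r       ≡⟨ ⊞-coeff 𝟙 (X ⊠ H) 0 r ⟨
    (𝟙 ⊞ X ⊠ H) 0 r             ∎
  where open ≡-Reasoning
≈𝟙⊞X⊠ G H G₀ G₊ (suc n) r = begin
    G (suc n) r                 ≡⟨ G₊ n r ⟩
    H n r                       ≡⟨ X⊠-suc H n r ⟨
    (X ⊠ H) (suc n) r           ≡⟨ ℤᵖ.+-identityˡ _ ⟨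
    + 0 ℤ.+ (X ⊠ H) (suc n) r   ≡⟨ ⊞-coeff 𝟙 (X ⊠ H) (suc n) r ⟨
    (𝟙 ⊞ X ⊠ H) (suc n) r       ∎
  where open ≡-Reasoning

completions-zero : ∀ σ r → + completions 0 σ r ≡ 𝟙 0 r
completions-zero σ zero    = refl
completions-zero σ (suc r) = refl

Runs-equation : ∀ k f →
  Runs k f ≈ 𝟙 ⊞ X ⊠ (Runs k f ⊞ RunsUpTo (k ∸ 1) ⊞ Reopen f k ⊞ Q ⊠ Runs (suc k) f)
Runs-equation k f = ≈𝟙⊞X⊠ (Runs k f) _ (completions-zero (runs k f)) step
  where
  byQ : ∀ n r → (Q ⊠ Runs (suc k) f) n r ≡ + shiftQ (completions n (runs (suc k) f)) r
  byQ n zero    = Q⊠-zero (Runs (suc k) f) n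
  byQ n (suc r) = Q⊠-suc (Runs (suc k) f) n r
  step : ∀ n r → Runs k f (suc n) r ≡ (Runs k f ⊞ RunsUpTo (k ∸ 1) ⊞ Reopen f k ⊞ Q ⊠ Runs (suc k) f) n r
  step n r = sym (begin
      (Runs k f ⊞ RunsUpTo (k ∸ 1) ⊞ Reopen f k ⊞ Q ⊠ Runs (suc k) f) n r
    ≡⟨ ⊞-coeff _ _ n r ⟩
      (Runs k f ⊞ RunsUpTo (k ∸ 1) ⊞ Reopen f k) n r ℤ.+ (Q ⊠ Runs (suc k) f) n r
    ≡⟨ cong₂ ℤ._+_ (⊞-coeff _ _ n r) (byQ n r) ⟩
      ((Runs k f ⊞ RunsUpTo (k ∸ 1)) n r ℤ.+ Reopen f k n r) ℤ.+ _
    ≡⟨ cong₂ (λ a b → (a ℤ.+ b) ℤ.+ + shiftQ (completions n (runs (suc k) f)) r)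
             (trans (⊞-coeff _ _ n r) (cong (λ z → Runs k f n r ℤ.+ z) (RunsUpTo-coeff (k ∸ 1) n r)))
             (Reopen-coeff f k n r) ⟩
      Runs k f (suc n) r
    ∎)
    where open ≡-Reasoning

Reopened-equation : ∀ k → Reopened k ≈ 𝟙 ⊞ X ⊠ (Reopened k ⊞ RunsUpTo k)
Reopened-equation k = ≈𝟙⊞X⊠ (Reopened k) _ (completions-zero (reopened k)) step
  where
  step : ∀ n r → Reopened k (suc n) r ≡ (Reopened k ⊞ RunsUpTo k) n r
  step n r = sym (trans (⊞-coeff _ _ n r) (cong (λ z → Reopened k n r ℤ.+ z) (RunsUpTo-coeff k n r)))

module _ where
  open GroupProperties 𝕊.+-group using (x≈y⇒x∙y⁻¹≈ε; x∙y⁻¹≈ε⇒x≈y)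

  ≈⇒-≈𝟘 : ∀ {F G} → F ≈ G → F ⊞ ⊟ G ≈ 𝟘
  ≈⇒-≈𝟘 = x≈y⇒x∙y⁻¹≈ε

  -≈𝟘⇒≈ : ∀ {F G} → F ⊞ ⊟ G ≈ 𝟘 → F ≈ G
  -≈𝟘⇒≈ = x∙y⁻¹≈ε⇒x≈y _ _

⊞-≈𝟘 : ∀ {F G} → F ≈ 𝟘 → G ≈ 𝟘 → F ⊞ G ≈ 𝟘
⊞-≈𝟘 F≈𝟘 G≈𝟘 = 𝕊.trans (𝕊.+-cong F≈𝟘 G≈𝟘) (𝕊.+-identityˡ 𝟘)

⊠-≈𝟘 : ∀ F {G} → G ≈ 𝟘 → F ⊠ G ≈ 𝟘
⊠-≈𝟘 F G≈𝟘 = 𝕊.trans (𝕊.*-congˡ G≈𝟘) (𝕊.zeroʳ F)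

⊟-≈𝟘 : ∀ {F} → F ≈ 𝟘 → ⊟ F ≈ 𝟘
⊟-≈𝟘 F≈𝟘 = 𝕊.trans (𝕊.-‿cong F≈𝟘) (RingProperties.-0#≈0# 𝕊.ring)

open Solver using (solve; _:=_; _:+_; _:*_; _:-_; :-_; con)

-- Solving the equations

W : ℕ → Ser
W j = 𝟙 ⊞ X ⊠ RunsUpTo j

ΔRuns : ℕ → Bool → Ser
ΔRuns j f = Runs (suc j) f ⊞ ⊟ (Runs 1 f ⊠ W j)

ΔReopened : ℕ → Ser
ΔReopened j = Reopened (suc j) ⊞ ⊟ (Reopened 1 ⊠ W j)

ΔReopen : Bool → ℕ → Ser
ΔReopen f j = Reopen f (suc j) ⊞ ⊟ (Reopen f 1 ⊠ W j)

-- Up to the ring axioms, ΔRuns j f - X ⊠ (…) is the equation for j + 1 minus W j times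
-- the equation for 1.
ΔRuns-equation : ∀ j f →
  ΔRuns j f ≈ X ⊠ (ΔRuns j f ⊞ ΔReopen f j ⊞ Q ⊠ (ΔRuns (suc j) f ⊞ ⊟ (ΔRuns 1 f ⊠ W j) ⊞ X ⊠ (Runs 1 f ⊠ ΔRuns j true)))
ΔRuns-equation j f = -≈𝟘⇒≈ (𝕊.trans
  (solve 11 (λ x q t t⁺ t₂ a a₁ t′ ℓ ℓ₁ s →
    let w   = con (+ 1) :+ x :* s
        w⁺  = con (+ 1) :+ x :* (t′ :+ s)
        w₁  = con (+ 1) :+ x :* (a₁ :+ con (+ 0))
        Δ   = t :- a :* w
        Δ⁺  = t⁺ :- a :* w⁺
        Δ₁  = t₂ :- a :* w₁
        Δ′  = t′ :- a₁ :* w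
        Δʳ  = ℓ :- ℓ₁ :* w
    in Δ :- x :* ((Δ :+ Δʳ) :+ q :* ((Δ⁺ :- Δ₁ :* w) :+ x :* (a :* Δ′)))
       := (t :- (con (+ 1) :+ x :* (((t :+ s) :+ ℓ) :+ q :* t⁺)))
          :- w :* (a :- (con (+ 1) :+ x :* (((a :+ con (+ 0)) :+ ℓ₁) :+ q :* t₂))))
    𝕊.refl X Q (Runs (suc j) f) (Runs (suc (suc j)) f) (Runs 2 f) (Runs 1 f) (Runs 1 true) (Runs (suc j) true)
      (Reopen f (suc j)) (Reopen f 1) (RunsUpTo j))
  (⊞-≈𝟘 (≈⇒-≈𝟘 (Runs-equation (suc j) f)) (⊟-≈𝟘 (⊠-≈𝟘 (W j) (≈⇒-≈𝟘 (Runs-equation 1 f))))))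

ΔReopened-equation : ∀ j → ΔReopened j ≈ X ⊠ (ΔReopened j ⊞ ΔRuns j true)
ΔReopened-equation j = -≈𝟘⇒≈ (𝕊.trans
  (solve 6 (λ x z z₁ t′ a₁ s →
    let w = con (+ 1) :+ x :* s
        Δ = z :- z₁ :* w
    in Δ :- x :* (Δ :+ (t′ :- a₁ :* w))
       := (z :- (con (+ 1) :+ x :* (z :+ (t′ :+ s))))
          :- w :* (z₁ :- (con (+ 1) :+ x :* (z₁ :+ (a₁ :+ con (+ 0))))))
    𝕊.refl X (Reopened (suc j)) (Reopened 1) (Runs (suc j) true) (Runs 1 true) (RunsUpTo j))
  (⊞-≈𝟘 (≈⇒-≈𝟘 (Reopened-equation (suc j))) (⊟-≈𝟘 (⊠-≈𝟘 (W j) (≈⇒-≈𝟘 (Reopened-equation 1))))))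

VanishesBelow : ℕ → Ser → Set
VanishesBelow N G = ∀ i → i < N → ∀ r → G i r ≡ + 0

VanishesBelow-≈ : ∀ {N F G} → F ≈ G → VanishesBelow N G → VanishesBelow N F
VanishesBelow-≈ F≈G G₀ i i<N r = trans (F≈G i r) (G₀ i i<N r)

VanishesBelow-⊞ : ∀ {N F G} → VanishesBelow N F → VanishesBelow N G → VanishesBelow N (F ⊞ G)
VanishesBelow-⊞ {F = F} {G} F₀ G₀ i i<N r rewrite ⊞-coeff F G i r | F₀ i i<N r | G₀ i i<N r = refl

VanishesBelow-⊟ : ∀ {N G} → VanishesBelow N G → VanishesBelow N (⊟ G)
VanishesBelow-⊟ {G = G} G₀ i i<N r rewrite ⊟-coeff G i r | G₀ i i<N r = refl

VanishesBelow-⊠ˡ : ∀ {N} F {G} → VanishesBelow N G → VanishesBelow N (F ⊠ G)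
VanishesBelow-⊠ˡ F {G} G₀ i i<N r =
  trans (⊠-coeff F G i r) (InX.conv-vanishing F G i (λ i′ i′≤i r′ → G₀ i′ (≤-<-trans i′≤i i<N) r′) r)

VanishesBelow-⊠ʳ : ∀ {N} F {G} → VanishesBelow N G → VanishesBelow N (G ⊠ F)
VanishesBelow-⊠ʳ F {G} G₀ = VanishesBelow-≈ (𝕊.*-comm G F) (VanishesBelow-⊠ˡ F G₀)

VanishesBelow-X⊠ : ∀ {N G} → VanishesBelow N G → VanishesBelow (suc N) (X ⊠ G)
VanishesBelow-X⊠ {G = G} G₀ zero    _         r = X⊠-zero G r
VanishesBelow-X⊠ {G = G} G₀ (suc i) (s≤s i<N) r = trans (X⊠-suc G i r) (G₀ i i<N r)

VanishesBelow-pred : ∀ {N G} → VanishesBelow (suc N) G → VanishesBelow N G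
VanishesBelow-pred G₀ i i<N = G₀ i (m≤n⇒m≤1+n i<N)

ΔVanishBelow : ℕ → Set
ΔVanishBelow N = (∀ j f → VanishesBelow N (ΔRuns j f)) × (∀ j → VanishesBelow N (ΔReopened j))

-- Each difference is X times a combination of differences, so one more x-coefficient
-- vanishes at every step.
Δ-vanish : ∀ N → ΔVanishBelow N
Δ-vanish zero    = (λ _ _ _ ()) , (λ _ _ ())
Δ-vanish (suc N) = runs₀ , reopened₀
  where
  ih : ΔVanishBelow N
  ih = Δ-vanish N
  reopen₀ : ∀ f j → VanishesBelow N (ΔReopen f j)
  reopen₀ true  j = proj₂ ih j
  reopen₀ false j = VanishesBelow-⊞ (λ i _ → ⟦0⟧-coeff i) (VanishesBelow-⊟ (VanishesBelow-⊠ʳ (W j) (λ i _ → ⟦0⟧-coeff i)))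
  runs₀ : ∀ j f → VanishesBelow (suc N) (ΔRuns j f)
  runs₀ j f = VanishesBelow-≈ (ΔRuns-equation j f) (VanishesBelow-X⊠
    (VanishesBelow-⊞ (VanishesBelow-⊞ (proj₁ ih j f) (reopen₀ f j))
      (VanishesBelow-⊠ˡ Q (VanishesBelow-⊞ (VanishesBelow-⊞ (proj₁ ih (suc j) f) (VanishesBelow-⊟ (VanishesBelow-⊠ʳ (W j) (proj₁ ih 1 f))))
        (VanishesBelow-pred (VanishesBelow-X⊠ (VanishesBelow-⊠ˡ (Runs 1 f) (proj₁ ih j true))))))))
  reopened₀ : ∀ j → VanishesBelow (suc N) (ΔReopened j)
  reopened₀ j = VanishesBelow-≈ (ΔReopened-equation j) (VanishesBelow-X⊠ (VanishesBelow-⊞ (proj₂ ih j) (proj₁ ih j true)))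

Runs-closed-form : ∀ j f → Runs (suc j) f ≈ Runs 1 f ⊠ W j
Runs-closed-form j f = -≈𝟘⇒≈ (λ n r → proj₁ (Δ-vanish (suc n)) j f n (n<1+n n) r)

A₀ A₁ Z₁ B R Y : Ser
A₀ = Runs 1 false
A₁ = Runs 1 true
Z₁ = Reopened 1
B  = 𝟙 ⊞ X ⊠ A₁
R  = X ⊠ A₀
Y  = (Q ⊠ X) ⊠ B

A₁-equation : A₁ ⊠ (𝟙 ⊞ ⊟ (⟦ + 2 ⟧ ⊠ X)) ≈ 𝟙 ⊞ (((Q ⊠ X) ⊠ (𝟙 ⊞ ⊟ X)) ⊠ A₁) ⊠ B
A₁-equation = -≈𝟘⇒≈ (𝕊.trans
  (solve 5 (λ x q a₁ z₁ t₂ →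
    let one = con (+ 1)
        b   = one :+ x :* a₁
    in (a₁ :* (one :- con (+ 2) :* x) :- (one :+ (((q :* x) :* (one :- x)) :* a₁) :* b))
       := ((one :- x) :* ((a₁ :- (one :+ x :* (((a₁ :+ con (+ 0)) :+ z₁) :+ q :* t₂)))
                          :+ (x :* q) :* (t₂ :- a₁ :* (one :+ x :* (a₁ :+ con (+ 0)))))
           :+ x :* (z₁ :- (one :+ x :* (z₁ :+ (a₁ :+ con (+ 0)))))))
    𝕊.refl X Q A₁ Z₁ (Runs 2 true))
  (⊞-≈𝟘 (⊠-≈𝟘 (𝟙 ⊞ ⊟ X) (⊞-≈𝟘 (≈⇒-≈𝟘 (Runs-equation 1 true)) (⊠-≈𝟘 (X ⊠ Q) (≈⇒-≈𝟘 (Runs-closed-form 1 true)))))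
        (⊠-≈𝟘 X (≈⇒-≈𝟘 (Reopened-equation 1)))))

A₀-equation : A₀ ⊠ ((𝟙 ⊞ ⊟ X) ⊞ ⊟ ((Q ⊠ X) ⊠ B)) ≈ 𝟙
A₀-equation = -≈𝟘⇒≈ (𝕊.trans
  (solve 5 (λ x q a₀ a₁ t₂ →
    let one = con (+ 1)
    in (a₀ :* ((one :- x) :- (q :* x) :* (one :+ x :* a₁)) :- one)
       := ((a₀ :- (one :+ x :* (((a₀ :+ con (+ 0)) :+ con (+ 0)) :+ q :* t₂)))
           :+ (x :* q) :* (t₂ :- a₀ :* (one :+ x :* (a₁ :+ con (+ 0))))))
    𝕊.refl X Q A₀ A₁ (Runs 2 false))
  (⊞-≈𝟘 (≈⇒-≈𝟘 (Runs-equation 1 false)) (⊠-≈𝟘 (X ⊠ Q) (≈⇒-≈𝟘 (Runs-closed-form 1 false)))))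

-- Y - q x = q x² A₁, so the A₁-equation becomes an equation in Y alone.
Y-equation : (Y ⊞ ⊟ (Q ⊠ X)) ⊠ (𝟙 ⊞ ⊟ (⟦ + 2 ⟧ ⊠ X)) ⊞ ⊟ ((Q ⊠ X) ⊠ X) ≈ ((𝟙 ⊞ ⊟ X) ⊠ (Y ⊞ ⊟ (Q ⊠ X))) ⊠ Y
Y-equation = -≈𝟘⇒≈ (𝕊.trans
  (solve 3 (λ x q a₁ →
    let one = con (+ 1)
        two = con (+ 2)
        b   = one :+ x :* a₁
        y   = (q :* x) :* b
    in ((y :- q :* x) :* (one :- two :* x) :- (q :* x) :* x :- ((one :- x) :* (y :- q :* x)) :* y)
       := ((q :* x) :* x) :* (a₁ :* (one :- two :* x) :- (one :+ (((q :* x) :* (one :- x)) :* a₁) :* b)))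
    𝕊.refl X Q A₁)
  (⊠-≈𝟘 ((Q ⊠ X) ⊠ X) (≈⇒-≈𝟘 A₁-equation)))

R-Y-relation : Y ⊠ R ≈ R ⊠ (𝟙 ⊞ ⊟ X) ⊞ ⊟ X
R-Y-relation = -≈𝟘⇒≈ (𝕊.trans
  (solve 4 (λ x q a₀ a₁ →
    let one = con (+ 1)
        y   = (q :* x) :* (one :+ x :* a₁)
        r   = x :* a₀
    in (y :* r :- (r :* (one :- x) :- x))
       := :- (x :* (a₀ :* ((one :- x) :- y) :- one)))
    𝕊.refl X Q A₀ A₁)
  (⊟-≈𝟘 (⊠-≈𝟘 X (≈⇒-≈𝟘 A₀-equation))))

-- Eliminating Y between the two previous equations; the result is divisible by X.
R-equation : R ≈ ((X ⊞ ⊟ (X ⊠ X)) ⊠ (𝟙 ⊞ R)) ⊠ (𝟙 ⊞ (Q ⊞ 𝟙) ⊠ R)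
R-equation = -≈𝟘⇒≈ (cancel-X (𝕊.trans
  (solve 4 (λ x q y r →
    let one = con (+ 1)
        two = con (+ 2)
        u   = x :- x :* x
        Qp  = (one :- two :* x) :* r :- (one :- x) :* (y :* r :+ (r :* (one :- x) :- x)) :+ (((one :- x) :* q) :* x) :* r
    in x :* (r :- ((u :* (one :+ r)) :* (one :+ ((q :+ one) :* r))))
       := (r :* r) :* ((y :- q :* x) :* (one :- two :* x) :- (q :* x) :* x :- ((one :- x) :* (y :- q :* x)) :* y)
          :- Qp :* (y :* r :- (r :* (one :- x) :- x)))
    𝕊.refl X Q Y R)
  (⊞-≈𝟘 (⊠-≈𝟘 (R ⊠ R) (≈⇒-≈𝟘 Y-equation)) (⊟-≈𝟘 (⊠-≈𝟘 _ (≈⇒-≈𝟘 R-Y-relation))))))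
  where
  cancel-X : ∀ {G} → X ⊠ G ≈ 𝟘 → G ≈ 𝟘
  cancel-X {G} XG≈𝟘 n r = trans (sym (X⊠-suc G n r)) (XG≈𝟘 (suc n) r)

pow : Ser → ℕ → Ser
pow G zero    = 𝟙
pow G (suc i) = G ⊠ pow G i

⟦⟧⊠-coeff : ∀ c G n r → (⟦ c ⟧ ⊠ G) n r ≡ c ℤ.* G n r
⟦⟧⊠-coeff c G n r = trans (⊠-coeff ⟦ c ⟧ G n r) (trans (InX.conv-const (InQ.const c) G n r) (InQ.conv-const c (G n) r))

𝟙⊠-coeff : ∀ G n r → (𝟙 ⊠ G) n r ≡ G n r
𝟙⊠-coeff G n r = trans (⟦⟧⊠-coeff (+ 1) G n r) (ℤᵖ.*-identityˡ (G n r))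

monomial : ℕ → ℕ → Ser
monomial i j n r = if (i ≡ᵇ n) ∧ (j ≡ᵇ r) then + 1 else + 0

pow-Q-coeff : ∀ j n r → pow Q j n r ≡ monomial 0 j n r
pow-Q-coeff zero    zero    zero    = refl
pow-Q-coeff zero    zero    (suc r) = refl
pow-Q-coeff zero    (suc n) r       = refl
pow-Q-coeff (suc j) n       zero    = trans (Q⊠-zero (pow Q j) n) (sym (if-false (0 ≡ᵇ n)))
  where
  if-false : ∀ b → (if b ∧ false then + 1 else + 0) ≡ + 0
  if-false true  = refl
  if-false false = refl
pow-Q-coeff (suc j) n       (suc r) = trans (Q⊠-suc (pow Q j) n r) (pow-Q-coeff j n r)

monomial-coeff : ∀ i j n r → (pow X i ⊠ pow Q j) n r ≡ monomial i j n r
monomial-coeff zero    j n       r = trans (𝟙⊠-coeff (pow Q j) n r) (pow-Q-coeff j n r)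
monomial-coeff (suc i) j n       r = trans (𝕊.*-assoc X (pow X i) (pow Q j) n r) (shifted n)
  where
  shifted : ∀ n → (X ⊠ (pow X i ⊠ pow Q j)) n r ≡ monomial (suc i) j n r
  shifted zero    = X⊠-zero (pow X i ⊠ pow Q j) r
  shifted (suc n) = trans (X⊠-suc (pow X i ⊠ pow Q j) n r) (monomial-coeff i j n r)

polynomial : List (ℕ × ℕ × ℤ) → Ser
polynomial []                 = ⟦ + 0 ⟧
polynomial ((i , j , c) ∷ ts) = ⟦ c ⟧ ⊠ (pow X i ⊠ pow Q j) ⊞ polynomial ts

poly≈polynomial : ∀ ts → poly ts ≈ polynomial ts
poly≈polynomial []                 n r = sym (⟦0⟧-coeff n r)
poly≈polynomial ((i , j , c) ∷ ts) n r = sym (begin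
    (⟦ c ⟧ ⊠ (pow X i ⊠ pow Q j) ⊞ polynomial ts) n r
  ≡⟨ ⊞-coeff _ (polynomial ts) n r ⟩
    (⟦ c ⟧ ⊠ (pow X i ⊠ pow Q j)) n r ℤ.+ polynomial ts n r
  ≡⟨ cong₂ ℤ._+_ (trans (⟦⟧⊠-coeff c _ n r) (cong (c ℤ.*_) (monomial-coeff i j n r))) (sym (poly≈polynomial ts n r)) ⟩
    c ℤ.* monomial i j n r ℤ.+ poly ts n r
  ≡⟨ cong (ℤ._+ poly ts n r) (select ((i ≡ᵇ n) ∧ (j ≡ᵇ r))) ⟩
    poly ((i , j , c) ∷ ts) n r
  ∎)
  where
  open ≡-Reasoning
  select : ∀ b → c ℤ.* (if b then + 1 else + 0) ≡ (if b then c else + 0)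
  select true  = ℤᵖ.*-identityʳ c
  select false = ℤᵖ.*-zeroʳ c

open Solver using (Polynomial)

powSyntax : ∀ {k} → Polynomial k → ℕ → Polynomial k
powSyntax p zero    = con (+ 1)
powSyntax p (suc i) = p :* powSyntax p i

polynomialSyntax : ∀ {k} → Polynomial k → Polynomial k → List (ℕ × ℕ × ℤ) → Polynomial k
polynomialSyntax x q []                 = con (+ 0)
polynomialSyntax x q ((i , j , c) ∷ ts) = con c :* (powSyntax x i :* powSyntax q j) :+ polynomialSyntax x q ts

Dterms Nterms Denterms qTerms : List (ℕ × ℕ × ℤ)
Dterms   = (0 , 0 , + 1) ∷ (1 , 1 , -[1+ 1 ]) ∷ (1 , 0 , -[1+ 3 ]) ∷ (2 , 2 , + 1) ∷ (2 , 1 , + 2) ∷ (2 , 0 , + 4)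
         ∷ (3 , 2 , -[1+ 1 ]) ∷ (4 , 2 , + 1) ∷ []
Nterms   = (0 , 1 , -[1+ 0 ]) ∷ (1 , 2 , + 1) ∷ (1 , 1 , + 2) ∷ (2 , 2 , -[1+ 0 ]) ∷ (2 , 1 , -[1+ 1 ]) ∷ []
Denterms = (2 , 1 , + 2) ∷ (2 , 0 , + 2) ∷ (1 , 1 , -[1+ 1 ]) ∷ (1 , 0 , -[1+ 1 ]) ∷ []
qTerms   = (0 , 1 , + 1) ∷ []

-- The square root is forced by the second equation: q √D = Den P - N.
√D : Ser
√D = 𝟙 ⊞ ⊟ (X ⊠ ((Q ⊞ ⟦ + 2 ⟧) ⊠ (𝟙 ⊞ ⊟ X) ⊞ (⟦ + 2 ⟧ ⊠ (Q ⊞ 𝟙)) ⊠ ((𝟙 ⊞ ⊟ X) ⊠ R)))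

√D-x⁰ : ∀ r → √D 0 r ≡ 𝟙 0 r
√D-x⁰ r = begin
    √D 0 r                               ≡⟨ ⊞-coeff 𝟙 _ 0 r ⟩
    𝟙 0 r ℤ.+ (⊟ (X ⊠ _)) 0 r            ≡⟨ cong (λ z → 𝟙 0 r ℤ.+ z) (trans (⊟-coeff _ 0 r) (cong ℤ.-_ (X⊠-zero _ r))) ⟩
    𝟙 0 r ℤ.+ + 0                        ≡⟨ ℤᵖ.+-identityʳ (𝟙 0 r) ⟩
    𝟙 0 r                                ∎
  where open ≡-Reasoning

-- √D ⊠ √D - D is a multiple of the difference of the two sides of R-equation.
√D-squared : √D ⊠ √D ≈ Dser
√D-squared = 𝕊.trans
  (solve 3 (λ x q r →
    let one = con (+ 1)
        two = con (+ 2)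
        u   = x :- x :* x
        s   = one :- x :* ((q :+ two) :* (one :- x) :+ (two :* (q :+ one)) :* ((one :- x) :* r))
    in s :* s := polynomialSyntax x q Dterms :+ (con -[1+ 3 ] :* ((q :+ one) :* u)) :* (r :- ((u :* (one :+ r)) :* (one :+ ((q :+ one) :* r)))))
    𝕊.refl X Q R)
  (𝕊.trans (𝕊.+-congˡ (⊠-≈𝟘 _ (≈⇒-≈𝟘 R-equation))) (𝕊.trans (𝕊.+-identityʳ _) (𝕊.sym (poly≈polynomial Dterms))))

Pq≈Q⊠R : Pq ≈ Q ⊠ R
Pq≈Q⊠R zero    zero    = sym (Q⊠-zero R 0)
Pq≈Q⊠R zero    (suc r) = sym (trans (Q⊠-suc R 0 r) (X⊠-zero A₀ r))
Pq≈Q⊠R (suc n) zero    = sym (Q⊠-zero R (suc n))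
Pq≈Q⊠R (suc n) (suc r) = trans (cong +_ (s≡completions n r)) (sym (trans (Q⊠-suc R (suc n) r) (X⊠-suc A₀ n r)))

Den⊠Pq : Den ⊠ Pq ≈ Nser ⊞ qSer ⊠ √D
Den⊠Pq = 𝕊.trans (𝕊.*-cong (poly≈polynomial Denterms) Pq≈Q⊠R) (𝕊.trans
  (solve 3 (λ x q r →
    let one = con (+ 1)
        two = con (+ 2)
        s   = one :- x :* ((q :+ two) :* (one :- x) :+ (two :* (q :+ one)) :* ((one :- x) :* r))
    in polynomialSyntax x q Denterms :* (q :* r) := polynomialSyntax x q Nterms :+ polynomialSyntax x q qTerms :* s)
    𝕊.refl X Q R)
  (𝕊.sym (𝕊.+-cong (poly≈polynomial Nterms) (𝕊.*-congʳ (poly≈polynomial qTerms)))))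

theorem1p2 : ∃ λ (S : Ser) →
      (S 0 0 ≡ + 1)
    × (∀ r → S 0 (suc r) ≡ + 0)
    × (∀ n r → (S ⊛ S) n r ≡ Dser n r)
    × (∀ n r → (Den ⊛ Pq) n r ≡ (Nser ⊕ (qSer ⊛ S)) n r)
theorem1p2 = √D , √D-x⁰ 0 , √D-x⁰ ∘ suc , square , equation
  where
  square : ∀ n r → (√D ⊛ √D) n r ≡ Dser n r
  square n r = trans (⊛≡⊠ √D √D n r) (√D-squared n r)
  equation : ∀ n r → (Den ⊛ Pq) n r ≡ (Nser ⊕ (qSer ⊛ √D)) n r
  equation n r = begin
      (Den ⊛ Pq) n r                     ≡⟨ ⊛≡⊠ Den Pq n r ⟩
      (Den ⊠ Pq) n r                     ≡⟨ Den⊠Pq n r ⟩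
      (Nser ⊞ qSer ⊠ √D) n r             ≡⟨ ⊞-coeff Nser (qSer ⊠ √D) n r ⟩
      Nser n r ℤ.+ (qSer ⊠ √D) n r       ≡⟨ cong (λ z → Nser n r ℤ.+ z) (⊛≡⊠ qSer √D n r) ⟨
      (Nser ⊕ (qSer ⊛ √D)) n r           ∎
    where open ≡-Reasoning
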